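{- For $m\ge1$, $n\ge0$, $k\ge0$, $$\tilde S^o[m,n,k]=\sum_{\omega\in\tilde S^o([n^m],k)}q^{\operatorname{inv}\omega},$$ where $\tilde S^o[m,n,k]=[km]!_m\,h_{n-k}([m-1],[2m-1],\dots,[(k+1)m-1])$.
   Context: $[j]=1+q+\dots+q^{j-1}$; $[km]!_m=[m][2m]\cdots[km]$ (empty product $1$ for $k=0$); $h_j$ is the complete homogeneous symmetric polynomial of degree $j$. Let $\zeta_m=e^{2\pi i/m}$, $i^c=\zeta_m^c\mathbf e_i$ for $i\in[n]$ (colors mod $m$), $[n^m]=\{0\}\cup\{i^c:i\in[n],0\le c<m\}$, $zS=\{zs:s\in S\}$. A colored set partition of type $(m,n)$ is a set partition of $[n^m]$ into blocks $S_0,\dots,S_{km}$ with (i) $0\in S_0$ and if some $i^c\in S_0$ then all $i^d\in S_0$; (ii) the nonzero blocks split into $k$ groups of $m$ distinct blocks of the form $S,\zeta_mS,\dots,\zeta_m^{m-1}S$. A super set partition additionally carries, for each base $i$ whose colors lie in $S_0$, a linear order of $\{i^0,\dots,i^{m-1}\}$ of the form $i^c,i^{c+1},\dots,i^{c+m-1}$ (exponents mod $m$) with $c\in\{1,\dots,m-1\}$. An ordered super set partition is a sequence $\omega=(S_0/S_1/\dots/S_{km})$ whose blocks (with the orders on $S_0$) form a super set partition with zero block $S_0$, and such that $S_{i+1}=\zeta_mS_i$ for every $i\in[km-1]$ not divisible by $m$; $\tilde S^o([n^m],k)$ is the set of these with $km+1$ blocks. With $\operatorname{minb}S$ the least base occurring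 in $S$ (and $0$ if $0\in S$), the inversions of $\omega$ are (1) pairs $(i^0,S_l)$ with $i^0\in S_j$, $j<l$, and $i\ge\operatorname{minb}S_l$, and (2) pairs $(i^0,i^c)$ with $i^0,i^c\in S_0$ and $i^c$ after $i^0$ in the order of base $i$; $\operatorname{inv}\omega$ is their number. -}

module Defs where

open import Level using (Level)
open import Data.Nat using (ℕ; zero; suc; NonZero)
import Data.Nat as ℕ
open import Data.Nat.DivMod using (_mod_; _%_)
open import Data.Nat.Divisibility using (_∣_)
open import Data.Fin as Fin using (Fin; toℕ)
open import Data.Fin.Properties using (any?)
open import Data.Vec using (Vec; lookup)
open import Data.List using (List; []; _∷_; allFin; map; foldr)
open import Data.Product using (Σ; _×_; _,_; ∃)
open import Relation.Nullary using (Dec; yes; no; ¬_)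
open import Relation.Nullary.Decidable using (_×-dec_)
open import Relation.Binary.PropositionalEquality using (_≡_; _≢_)
open import Function.Bundles using (_⇔_)
open import Algebra.Bundles using (CommutativeSemiring)

count : ∀ {p : Level} {n : ℕ} {P : Fin n → Set p} → (∀ i → Dec (P i)) → ℕ
count {n = n} P? = foldr ℕ._+_ 0 (map (λ i → ind (P? i)) (allFin n))
  where
  ind : ∀ {p} {A : Set p} → Dec A → ℕ
  ind (yes _) = 1
  ind (no _)  = 0

-- Candidate data for an ordered super set partition of type (m,n)
-- with k*m + 1 blocks S_0, ..., S_{km}.
--
-- Base i ∈ [n] is represented by  i' : Fin n  (i = toℕ i' + 1), colour c by
-- c : Fin m.  The element 0 always lies in S_0.
--   blocks ! i ! c  = index l of the block S_l containing i^c
--   ord    ! i      = the c ∈ {1,…,m-1} of the linear order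
--                     i^c, i^{c+1}, …, i^{c+m-1} when the colours of base i
--                     lie in S_0; 0 (a dummy) otherwise.

record Cand (m n k : ℕ) : Set where
  constructor cand
  field
    blocks : Vec (Vec (Fin (suc (k ℕ.* m))) m) n
    ord    : Vec (Fin m) n

module _ {m n k : ℕ} where
  open Cand

  blk : Cand m n k → Fin n → Fin m → Fin (suc (k ℕ.* m))
  blk ω i c = lookup (lookup (blocks ω) i) c

  col0 : {{_ : NonZero m}} → Fin m
  col0 = 0 mod m

  -- ζ_m · i^c = i^{c+1} (colours mod m)
  next : {{_ : NonZero m}} → Fin m → Fin m
  next c = suc (toℕ c) mod m

  record IsOSSP {{_ : NonZero m}} (ω : Cand m n k) : Set where
    field
      -- every block S_l with l ≥ 1 is nonempty (S_0 contains 0)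
      nonempty : ∀ (l : Fin (suc (k ℕ.* m))) → l ≢ Fin.zero →
                 ∃ λ (i : Fin n) → ∃ λ (c : Fin m) → blk ω i c ≡ l
      zeroClosed : ∀ (i : Fin n) (c d : Fin m) →
                   blk ω i c ≡ Fin.zero → blk ω i d ≡ Fin.zero
      -- S_{l+1} = ζ_m S_l for l ∈ [km-1] not divisible by m
      rotate : ∀ (l : ℕ) → 1 ℕ.≤ l → l ℕ.< k ℕ.* m → ¬ (m ∣ l) →
               ∀ (i : Fin n) (c : Fin m) →
               (toℕ (blk ω i c) ≡ l) ⇔ (toℕ (blk ω i (next c)) ≡ suc l)
      ordIn  : ∀ (i : Fin n) → blk ω i col0 ≡ Fin.zero → toℕ (lookup (ord ω) i) ≢ 0
      -- dummy value when the base is not in S_0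
      ordOut : ∀ (i : Fin n) → blk ω i col0 ≢ Fin.zero → toℕ (lookup (ord ω) i) ≡ 0

  -- position of colour d in the order i^{c0}, i^{c0+1}, …, i^{c0+m-1}
  pos : {{_ : NonZero m}} → Fin m → Fin m → ℕ
  pos c0 d = (toℕ d ℕ.+ (m ℕ.∸ toℕ c0)) % m

  -- inversions of type (1): pairs (i^0, S_l) with i^0 ∈ S_j, j < l,
  -- and i ≥ minb S_l (i.e. some base i' ≤ i occurs in S_l)
  inv₁ : {{_ : NonZero m}} → Cand m n k → ℕ
  inv₁ ω = foldr ℕ._+_ 0 (map (λ i → count (λ l →
             (blk ω i col0 Fin.<? l) ×-dec
             any? (λ i' → (i' Fin.≤? i) ×-dec any? (λ c → blk ω i' c Fin.≟ l))))
           (allFin n))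

  -- inversions of type (2): pairs (i^0, i^c) with i^0, i^c ∈ S_0 and i^c
  -- after i^0 in the order of base i
  inv₂ : {{_ : NonZero m}} → Cand m n k → ℕ
  inv₂ ω = foldr ℕ._+_ 0 (map (λ i → count (λ c →
             (blk ω i col0 Fin.≟ Fin.zero) ×-dec
             (blk ω i c Fin.≟ Fin.zero) ×-dec
             (pos (lookup (Cand.ord ω) i) col0 ℕ.<? pos (lookup (Cand.ord ω) i) c)))
           (allFin n))

  inv : {{_ : NonZero m}} → Cand m n k → ℕ
  inv ω = inv₁ ω ℕ.+ inv₂ ω

module QAnalogues {c ℓ} (R : CommutativeSemiring c ℓ) where
  open CommutativeSemiring R
  open import Data.Nat using () renaming (_*_ to _*ℕ_)

  pow : Carrier → ℕ → Carrier
  pow x zero    = 1#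
  pow x (suc j) = x * pow x j

  qint : Carrier → ℕ → Carrier
  qint q zero    = 0#
  qint q (suc j) = 1# + q * qint q j

  -- [km]!_m = [m][2m]⋯[km]
  qfactm : Carrier → ℕ → ℕ → Carrier
  qfactm q m zero    = 1#
  qfactm q m (suc k) = qfactm q m k * qint q (suc k *ℕ m)

  h : ℕ → List Carrier → Carrier
  h zero    xs       = 1#
  h (suc d) []       = 0#
  h (suc d) (x ∷ xs) = x * h d (x ∷ xs) + h (suc d) xs

  -- h_{n-k}, which is 0 when n < k
  hdiff : ℕ → ℕ → List Carrier → Carrier
  hdiff n       zero    xs = h n xs
  hdiff zero    (suc k) xs = 0#
  hdiff (suc n) (suc k) xs = hdiff n k xs

  args : Carrier → ℕ → ℕ → List Carrier
  args q m k = map (λ j → qint q ((suc (toℕ j)) *ℕ m ℕ.∸ 1)) (allFin (suc k))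

  Stilde : Carrier → ℕ → ℕ → ℕ → Carrier
  Stilde q m n k = qfactm q m k * hdiff n k (args q m k)

  invSum : ∀ {m n k : ℕ} {{_ : NonZero m}} → Carrier → List (Cand m n k) → Carrier
  invSum q []      = 0#
  invSum q (ω ∷ l) = pow q (inv ω) + invSum q l

-- Each base i goes either entirely into S₀, where the order on its colours is fixed by the
-- starting colour o + 1, or into one group g of m rotated blocks, colour c landing in block
-- 1 + m g + ((s + c) mod m): the rotation condition forces this shape, and a candidate is an
-- ordered super set partition exactly when every group is used. The inversions of a base only
-- involve bases of smaller index, so appending a base to a sequence that uses the groups T adds
-- m|T| + o inversions in the first case and (m − 1 − s) + m·#{g′ ∈ T | g′ > g} in the second.
-- Hence the sum W(n, T) of q^inv over sequences of n bases using exactly the groups T satisfies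
--   W(n + 1, T) = q^{m|T|} [m − 1] W(n, T) + Σ_{g ∈ T} [m] q^{m·#{g′ ∈ T | g′ > g}} (W(n, T) + W(n, T − g)),
-- and since Σ_{g ∈ T} [m] q^{m·#{g′ ∈ T | g′ > g}} = [m|T|], this is the recursion
--   S̃[m, n + 1, t] = [m − 1 + tm] S̃[m, n, t] + [tm] S̃[m, n, t − 1]
-- of [tm]!_m h_{n−t}([m − 1], …, [(t + 1)m − 1]) in t = |T|. Taking T to be all k groups gives the theorem.

module Submission where

open import Defs
open import Data.Nat using (ℕ; NonZero)
open import Data.List using (List)
open import Data.List.Membership.Propositional using (_∈_)
open import Data.List.Relation.Unary.Unique.Propositional using (Unique)
open import Data.Product using (∃; _×_)
open import Function.Bundles using (_⇔_)
open import Algebra.Bundles using (CommutativeSemiring)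

open import Level using (Level)
open import Function using (_∘_; id)
open import Function.Bundles using (mk⇔; Equivalence)
open import Relation.Nullary using (Dec; yes; no; does; ¬_; contradiction)
open import Relation.Nullary.Decidable using (_×-dec_)
import Relation.Binary.PropositionalEquality as ≡
open ≡ using (_≡_; _≢_)
open import Data.Product using (_,_; proj₁; proj₂)
import Data.Product as Product
open import Data.Sum using (inj₁; inj₂)
import Data.Empty as Empty
open import Data.Bool using (if_then_else_)
import Data.Bool.Properties as Bool
import Data.Nat as ℕ
import Data.Nat.Properties as ℕ
open import Data.Nat.DivMod
  using (_mod_; _%_; %-distribˡ-+; m%n%n≡m%n; [m+n]%n≡m%n; m<n⇒m%n≡m; n%n≡0; %-remove-+ˡ)
open import Data.Nat.Divisibility using (_∣_; m∣m*n; n∣m*n; n∣m⇒m%n≡0)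
open import Data.Fin as Fin using (Fin; zero; suc; toℕ; inject₁; fromℕ; _↑ˡ_; _↑ʳ_; combine)
import Data.Fin.Properties as Fin
open import Data.Fin.Properties
  using (toℕ-fromℕ<; toℕ-injective; toℕ<n; toℕ-combine; combine-remQuot; combine-injective)
open import Data.Fin.Subset using (Subset; ⁅_⁆; _∪_; _-_; ⊤; ⊥; ∣_∣; inside; outside)
  renaming (_∈_ to _∈ₛ_; _∉_ to _∉ₛ_)
open import Data.Fin.Subset.Properties
  using ( _∈?_; ∪-identityˡ; ∪-identityʳ; ∪-assoc; ∣⊥∣≡0; ∣⊤∣≡n; p─⊥≡p
        ; x∈p∪q⁺; x∈p∪q⁻; x∈⁅x⁆; x∈⁅y⁆⇒x≡y; ∉⊥; ∈⊤; ⊆-antisym)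
open import Data.List as List using ([]; _∷_; _++_; foldr; map; filter; allFin; cartesianProductWith)
import Data.List.Properties as List
open import Data.Vec as Vec using (Vec; []; _∷_; lookup; here; there)
import Data.Vec.Properties as Vec
open import Data.Vec.Relation.Binary.Pointwise.Extensional using (ext; Pointwise-≡⇒≡)

module Sums {c ℓ} (S : CommutativeSemiring c ℓ) where
  open CommutativeSemiring S hiding (zero)
  open import Relation.Binary.Reasoning.Setoid setoid
  open import Algebra.Properties.CommutativeSemigroup +-commutativeSemigroup using (interchange)

  private variable
    a b p : Level
    A B C : Set a
    P Q : Set p

  ∑ : List A → (A → Carrier) → Carrier
  ∑ []       f = 0#
  ∑ (x ∷ xs) f = f x + ∑ xs f

  ∑-foldr : ∀ (xs : List A) (f : A → Carrier) → ∑ xs f ≡ foldr _+_ 0# (map f xs)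
  ∑-foldr []       f = ≡.refl
  ∑-foldr (x ∷ xs) f = ≡.cong (f x +_) (∑-foldr xs f)

  𝟙 : Dec P → Carrier
  𝟙 d = if does d then 1# else 0#

  𝟙-yes : (d : Dec P) → P → 𝟙 d ≈ 1#
  𝟙-yes (yes _) _ = refl
  𝟙-yes (no ¬p) p = contradiction p ¬p

  𝟙-no : (d : Dec P) → ¬ P → 𝟙 d ≈ 0#
  𝟙-no (yes p) ¬p = contradiction p ¬p
  𝟙-no (no _)  _  = refl

  𝟙-cong : (d : Dec P) (e : Dec Q) → (P → Q) → (Q → P) → 𝟙 d ≈ 𝟙 e
  𝟙-cong d (yes q) _ Q→P = 𝟙-yes d (Q→P q)
  𝟙-cong d (no ¬q) P→Q _ = 𝟙-no d (¬q ∘ P→Q)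

  𝟙-× : (d : Dec P) (e : Dec Q) → 𝟙 (d ×-dec e) ≈ 𝟙 d * 𝟙 e
  𝟙-× (yes _) (yes _) = sym (*-identityˡ 1#)
  𝟙-× (yes _) (no _)  = sym (*-identityˡ 0#)
  𝟙-× (no _)  _       = sym (zeroˡ _)

  𝟙-*-cong : ∀ (d : Dec P) {x y} → (P → x ≈ y) → 𝟙 d * x ≈ 𝟙 d * y
  𝟙-*-cong (yes p) x≈y = *-cong refl (x≈y p)
  𝟙-*-cong (no _)  _   = trans (zeroˡ _) (sym (zeroˡ _))

  ∑-cong : ∀ (xs : List A) {f g : A → Carrier} → (∀ x → f x ≈ g x) → ∑ xs f ≈ ∑ xs g
  ∑-cong []       f≈g = refl
  ∑-cong (x ∷ xs) f≈g = +-cong (f≈g x) (∑-cong xs f≈g)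

  ∑-zero : ∀ (xs : List A) {f : A → Carrier} → (∀ x → f x ≈ 0#) → ∑ xs f ≈ 0#
  ∑-zero []       f≈0 = refl
  ∑-zero (x ∷ xs) f≈0 = trans (+-cong (f≈0 x) (∑-zero xs f≈0)) (+-identityˡ 0#)

  ∑-map : ∀ (h : A → B) (xs : List A) (f : B → Carrier) → ∑ (map h xs) f ≡.≡ ∑ xs (f ∘ h)
  ∑-map h []       f = ≡.refl
  ∑-map h (x ∷ xs) f = ≡.cong (f (h x) +_) (∑-map h xs f)

  ∑-++ : ∀ (xs ys : List A) (f : A → Carrier) → ∑ (xs ++ ys) f ≈ ∑ xs f + ∑ ys f
  ∑-++ []       ys f = sym (+-identityˡ _)
  ∑-++ (x ∷ xs) ys f = trans (+-cong refl (∑-++ xs ys f)) (sym (+-assoc _ _ _))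

  ∑-+ : ∀ (xs : List A) (f g : A → Carrier) → ∑ xs (λ x → f x + g x) ≈ ∑ xs f + ∑ xs g
  ∑-+ []       f g = sym (+-identityˡ 0#)
  ∑-+ (x ∷ xs) f g = trans (+-cong refl (∑-+ xs f g)) (interchange _ _ _ _)

  ∑-*ˡ : ∀ (xs : List A) u (f : A → Carrier) → ∑ xs (λ x → u * f x) ≈ u * ∑ xs f
  ∑-*ˡ []       u f = sym (zeroʳ u)
  ∑-*ˡ (x ∷ xs) u f = trans (+-cong refl (∑-*ˡ xs u f)) (sym (distribˡ u _ _))

  ∑-*ʳ : ∀ (xs : List A) u (f : A → Carrier) → ∑ xs (λ x → f x * u) ≈ ∑ xs f * u
  ∑-*ʳ []       u f = sym (zeroˡ u)
  ∑-*ʳ (x ∷ xs) u f = trans (+-cong refl (∑-*ʳ xs u f)) (sym (distribʳ u _ _))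

  ∑-comm : ∀ (xs : List A) (ys : List B) (f : A → B → Carrier) →
           ∑ xs (λ x → ∑ ys (f x)) ≈ ∑ ys (λ y → ∑ xs (λ x → f x y))
  ∑-comm []       ys f = sym (∑-zero ys (λ _ → refl))
  ∑-comm (x ∷ xs) ys f = trans (+-cong refl (∑-comm xs ys f)) (sym (∑-+ ys (f x) _))

  ∑-cartesianProductWith : ∀ (h : A → B → C) (xs : List A) (ys : List B) (f : C → Carrier) →
                           ∑ (cartesianProductWith h xs ys) f ≈ ∑ xs (λ x → ∑ ys (f ∘ h x))
  ∑-cartesianProductWith h []       ys f = refl
  ∑-cartesianProductWith h (x ∷ xs) ys f = begin
    ∑ (map (h x) ys ++ cartesianProductWith h xs ys) f      ≈⟨ ∑-++ (map (h x) ys) _ f ⟩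
    ∑ (map (h x) ys) f + ∑ (cartesianProductWith h xs ys) f ≈⟨ +-cong (reflexive (∑-map (h x) ys f))
                                                                        (∑-cartesianProductWith h xs ys f) ⟩
    ∑ ys (f ∘ h x) + ∑ xs (λ x′ → ∑ ys (f ∘ h x′))          ∎

  ∑-filter : ∀ {P : A → Set p} (P? : ∀ x → Dec (P x)) (xs : List A) (f : A → Carrier) →
             ∑ (filter P? xs) f ≈ ∑ xs (λ x → 𝟙 (P? x) * f x)
  ∑-filter P? []       f = refl
  ∑-filter P? (x ∷ xs) f with P? x
  ... | yes _ = +-cong (sym (*-identityˡ (f x))) (∑-filter P? xs f)
  ... | no _  = trans (∑-filter P? xs f) (sym (trans (+-cong (zeroˡ (f x)) refl) (+-identityˡ _)))

  ∑-allFin-suc : ∀ n (f : Fin (ℕ.suc n) → Carrier) → ∑ (allFin (ℕ.suc n)) f ≈ f zero + ∑ (allFin n) (f ∘ suc)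
  ∑-allFin-suc n f = +-cong refl (reflexive (≡.trans (≡.cong (λ xs → ∑ xs f) (≡.sym (List.map-tabulate id suc)))
                                                       (∑-map suc (allFin n) f)))

  ∑-allFin-last : ∀ n (f : Fin (ℕ.suc n) → Carrier) →
                  ∑ (allFin (ℕ.suc n)) f ≈ ∑ (allFin n) (f ∘ inject₁) + f (fromℕ n)
  ∑-allFin-last ℕ.zero    f = trans (+-identityʳ _) (sym (+-identityˡ _))
  ∑-allFin-last (ℕ.suc n) f = begin
    ∑ (allFin (ℕ.suc (ℕ.suc n))) f                                    ≈⟨ ∑-allFin-suc (ℕ.suc n) f ⟩
    f zero + ∑ (allFin (ℕ.suc n)) (f ∘ suc)                           ≈⟨ +-cong refl (∑-allFin-last n (f ∘ suc)) ⟩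
    f zero + (∑ (allFin n) (f ∘ suc ∘ inject₁) + f (fromℕ (ℕ.suc n))) ≈⟨ sym (+-assoc _ _ _) ⟩
    (f zero + ∑ (allFin n) (f ∘ suc ∘ inject₁)) + f (fromℕ (ℕ.suc n))
      ≈⟨ +-cong (sym (∑-allFin-suc n (f ∘ inject₁))) refl ⟩
    ∑ (allFin (ℕ.suc n)) (f ∘ inject₁) + f (fromℕ (ℕ.suc n))          ∎

  ∑-allFin-+ : ∀ m n (f : Fin (m ℕ.+ n) → Carrier) →
               ∑ (allFin (m ℕ.+ n)) f ≈ ∑ (allFin m) (f ∘ (_↑ˡ n)) + ∑ (allFin n) (f ∘ (m ↑ʳ_))
  ∑-allFin-+ ℕ.zero    n f = sym (+-identityˡ _)
  ∑-allFin-+ (ℕ.suc m) n f = begin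
    ∑ (allFin (ℕ.suc m ℕ.+ n)) f                                                   ≈⟨ ∑-allFin-suc (m ℕ.+ n) f ⟩
    f zero + ∑ (allFin (m ℕ.+ n)) (f ∘ suc)
      ≈⟨ +-cong refl (∑-allFin-+ m n (f ∘ suc)) ⟩
    f zero + (∑ (allFin m) (f ∘ suc ∘ (_↑ˡ n)) + ∑ (allFin n) (f ∘ suc ∘ (m ↑ʳ_))) ≈⟨ sym (+-assoc _ _ _) ⟩
    (f zero + ∑ (allFin m) (f ∘ suc ∘ (_↑ˡ n))) + ∑ (allFin n) (f ∘ suc ∘ (m ↑ʳ_))
      ≈⟨ +-cong (sym (∑-allFin-suc m (f ∘ (_↑ˡ n)))) refl ⟩
    ∑ (allFin (ℕ.suc m)) (f ∘ (_↑ˡ n)) + ∑ (allFin n) (f ∘ (ℕ.suc m ↑ʳ_))          ∎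

  ∑-allFin-combine : ∀ k m (f : Fin (k ℕ.* m) → Carrier) →
                     ∑ (allFin (k ℕ.* m)) f ≈ ∑ (allFin k) (λ g → ∑ (allFin m) (f ∘ combine {k} g))
  ∑-allFin-combine ℕ.zero    m f = refl
  ∑-allFin-combine (ℕ.suc k) m f = begin
    ∑ (allFin (m ℕ.+ k ℕ.* m)) f                                        ≈⟨ ∑-allFin-+ m (k ℕ.* m) f ⟩
    ∑ (allFin m) (f ∘ (_↑ˡ k ℕ.* m)) + ∑ (allFin (k ℕ.* m)) (f ∘ (m ↑ʳ_))
      ≈⟨ +-cong refl (∑-allFin-combine k m (f ∘ (m ↑ʳ_))) ⟩
    ∑ (allFin m) (f ∘ combine {ℕ.suc k} zero) + ∑ (allFin k) (λ g → ∑ (allFin m) (f ∘ combine {ℕ.suc k} (suc g)))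
      ≈⟨ sym (∑-allFin-suc k _) ⟩
    ∑ (allFin (ℕ.suc k)) (λ g → ∑ (allFin m) (f ∘ combine {ℕ.suc k} g)) ∎

module _ where
  open import Data.Nat using (_+_; _*_; _∸_; _≤_; _<_)
  open ≡ using (sym; trans; cong)

  module _ (d : ℕ) .{{_ : NonZero d}} where

    [m%d+n]%d≡[m+n]%d : ∀ m n → (m % d + n) % d ≡ (m + n) % d
    [m%d+n]%d≡[m+n]%d m n = trans (%-distribˡ-+ (m % d) n d)
                                  (trans (cong (λ x → (x + n % d) % d) (m%n%n≡m%n m d)) (sym (%-distribˡ-+ m n d)))

    [m+n%d]%d≡[m+n]%d : ∀ m n → (m + n % d) % d ≡ (m + n) % d
    [m+n%d]%d≡[m+n]%d m n = trans (cong (_% d) (ℕ.+-comm m (n % d)))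
                                  (trans ([m%d+n]%d≡[m+n]%d n m) (cong (_% d) (ℕ.+-comm n m)))

  m+n+[o∸m]≡n+o : ∀ {m o} n → m ≤ o → m + n + (o ∸ m) ≡ n + o
  m+n+[o∸m]≡n+o {m} {o} n m≤o = begin
    m + n + (o ∸ m)   ≡⟨ cong (_+ (o ∸ m)) (ℕ.+-comm m n) ⟩
    n + m + (o ∸ m)   ≡⟨ ℕ.+-assoc n m (o ∸ m) ⟩
    n + (m + (o ∸ m)) ≡⟨ cong (n +_) (ℕ.m+[n∸m]≡n m≤o) ⟩
    n + o             ∎
    where open ≡.≡-Reasoning

  m*a+s<m*b+t : ∀ m {a b} s t → a < b → s < m → m * a + s < m * b + t
  m*a+s<m*b+t m {a} {b} s t a<b s<m = begin-strict
    m * a + s   <⟨ ℕ.+-monoʳ-< (m * a) s<m ⟩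
    m * a + m   ≡⟨ trans (ℕ.+-comm (m * a) m) (sym (ℕ.*-suc m a)) ⟩
    m * ℕ.suc a ≤⟨ ℕ.*-monoʳ-≤ m a<b ⟩
    m * b       ≤⟨ ℕ.m≤m+n (m * b) t ⟩
    m * b + t   ∎
    where open ℕ.≤-Reasoning

  ⇔-chain : ∀ {p} {P : ℕ → Set p} n → (∀ r → ℕ.suc r < n → P r ⇔ P (ℕ.suc r)) →
            ∀ {a b} → a < n → b < n → P a → P b
  ⇔-chain {P = P} n step {a} {b} a<n b<n = up b b<n ∘ down a a<n
    where
    down : ∀ a → a < n → P a → P 0
    down ℕ.zero    _   = id
    down (ℕ.suc a) a<n = down a (ℕ.<-trans (ℕ.n<1+n a) a<n) ∘ Equivalence.from (step a a<n)
    up : ∀ b → b < n → P 0 → P b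
    up ℕ.zero    _   = id
    up (ℕ.suc b) b<n = Equivalence.to (step b b<n) ∘ up b (ℕ.<-trans (ℕ.n<1+n b) b<n)

module _ {a} {A : Set a} where
  open ≡ using (refl; cong)

  lookup-∷ʳ-inject₁ : ∀ {n} (xs : Vec A n) x i → lookup (xs Vec.∷ʳ x) (inject₁ i) ≡ lookup xs i
  lookup-∷ʳ-inject₁ (_ ∷ xs) x zero    = refl
  lookup-∷ʳ-inject₁ (_ ∷ xs) x (suc i) = lookup-∷ʳ-inject₁ xs x i

  lookup-∷ʳ-last : ∀ {n} (xs : Vec A n) x → lookup (xs Vec.∷ʳ x) (fromℕ n) ≡ x
  lookup-∷ʳ-last []       x = refl
  lookup-∷ʳ-last (_ ∷ xs) x = lookup-∷ʳ-last xs x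

  map-∷ʳ : ∀ {b} {B : Set b} (f : A → B) {n} (xs : Vec A n) x →
           Vec.map f (xs Vec.∷ʳ x) ≡ Vec.map f xs Vec.∷ʳ f x
  map-∷ʳ f []       x = refl
  map-∷ʳ f (y ∷ xs) x = cong (f y ∷_) (map-∷ʳ f xs x)

map-allFin-toℕ : ∀ {a} {A : Set a} (f : ℕ → A) n → map (f ∘ toℕ) (allFin n) ≡ List.applyUpTo f n
map-allFin-toℕ f n = ≡.trans (List.map-tabulate id (f ∘ toℕ)) (tabulate-toℕ f n)
  where
  tabulate-toℕ : ∀ {a} {A : Set a} (f : ℕ → A) n → List.tabulate (f ∘ toℕ {n}) ≡ List.applyUpTo f n
  tabulate-toℕ f ℕ.zero    = ≡.refl
  tabulate-toℕ f (ℕ.suc n) = ≡.cong (f 0 ∷_) (tabulate-toℕ (f ∘ ℕ.suc) n)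

∃≤inject₁⇔ : ∀ {p n} {P : Fin (ℕ.suc n) → Set p} (i : Fin n) →
             (∃ λ j → j Fin.≤ inject₁ i × P j) ⇔ (∃ λ j → j Fin.≤ i × P (inject₁ j))
∃≤inject₁⇔ {n = n} {P} i = mk⇔ to from
  where
  from : (∃ λ j → j Fin.≤ i × P (inject₁ j)) → ∃ λ j → j Fin.≤ inject₁ i × P j
  from (j , j≤i , pj) = inject₁ j , ≡.subst₂ ℕ._≤_ (≡.sym (Fin.toℕ-inject₁ j)) (≡.sym (Fin.toℕ-inject₁ i)) j≤i , pj
  to : (∃ λ j → j Fin.≤ inject₁ i × P j) → ∃ λ j → j Fin.≤ i × P (inject₁ j)
  to (j , j≤i , pj) = Fin.lower₁ j n≢j , ≡.subst (ℕ._≤ toℕ i) (≡.sym (Fin.toℕ-lower₁ j n≢j)) j≤i′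
                    , ≡.subst P (≡.sym (Fin.inject₁-lower₁ j n≢j)) pj
    where
    j≤i′ : toℕ j ℕ.≤ toℕ i
    j≤i′ = ≡.subst (toℕ j ℕ.≤_) (Fin.toℕ-inject₁ i) j≤i
    n≢j : n ≢ toℕ j
    n≢j n≡j = ℕ.<⇒≱ (toℕ<n i) (≡.subst (ℕ._≤ toℕ i) (≡.sym n≡j) j≤i′)

module _ where
  open ≡ using (refl; sym; trans; cong; cong₂)

  x∈p⇒p∪⁅x⁆≡p : ∀ {n} (p : Subset n) {x} → x ∈ₛ p → p ∪ ⁅ x ⁆ ≡ p
  x∈p⇒p∪⁅x⁆≡p (inside ∷ p) here        = cong (inside ∷_) (∪-identityʳ p)
  x∈p⇒p∪⁅x⁆≡p (s ∷ p)      (there x∈p) = cong₂ _∷_ (Bool.∨-identityʳ s) (x∈p⇒p∪⁅x⁆≡p p x∈p)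

  x∉p⇒[p∪⁅x⁆]-x≡p : ∀ {n} (p : Subset n) {x} → x ∉ₛ p → (p ∪ ⁅ x ⁆) - x ≡ p
  x∉p⇒[p∪⁅x⁆]-x≡p (inside ∷ p)  {zero}  x∉p = contradiction here x∉p
  x∉p⇒[p∪⁅x⁆]-x≡p (outside ∷ p) {zero}  _   = cong (outside ∷_) (trans (p─⊥≡p _) (∪-identityʳ p))
  x∉p⇒[p∪⁅x⁆]-x≡p (s ∷ p)       {suc x} x∉p = cong₂ _∷_ (Bool.∨-identityʳ s) (x∉p⇒[p∪⁅x⁆]-x≡p p (x∉p ∘ there))

  x∈p⇒[p-x]∪⁅x⁆≡p : ∀ {n} (p : Subset n) {x} → x ∈ₛ p → (p - x) ∪ ⁅ x ⁆ ≡ p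
  x∈p⇒[p-x]∪⁅x⁆≡p (inside ∷ p) here        = cong (inside ∷_) (trans (∪-identityʳ _) (p─⊥≡p p))
  x∈p⇒[p-x]∪⁅x⁆≡p (s ∷ p)      (there x∈p) = cong₂ _∷_ (Bool.∨-identityʳ s) (x∈p⇒[p-x]∪⁅x⁆≡p p x∈p)

  x∉p-x : ∀ {n} (p : Subset n) x → x ∉ₛ p - x
  x∉p-x (_ ∷ p) zero    ()
  x∉p-x (_ ∷ p) (suc x) (there x∈p-x) = x∉p-x p x x∈p-x

  ∣p∣≡0⇒p≡⊥ : ∀ {n} (p : Subset n) → ∣ p ∣ ≡ 0 → p ≡ ⊥
  ∣p∣≡0⇒p≡⊥ []            _     = refl
  ∣p∣≡0⇒p≡⊥ (outside ∷ p) ∣p∣≡0 = cong (outside ∷_) (∣p∣≡0⇒p≡⊥ p ∣p∣≡0)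

  x∈p⇒1+∣p-x∣≡∣p∣ : ∀ {n} (p : Subset n) {x} → x ∈ₛ p → ℕ.suc ∣ p - x ∣ ≡ ∣ p ∣
  x∈p⇒1+∣p-x∣≡∣p∣ (inside ∷ p)  here        = cong (ℕ.suc ∘ ∣_∣) (p─⊥≡p p)
  x∈p⇒1+∣p-x∣≡∣p∣ (inside ∷ p)  (there x∈p) = cong ℕ.suc (x∈p⇒1+∣p-x∣≡∣p∣ p x∈p)
  x∈p⇒1+∣p-x∣≡∣p∣ (outside ∷ p) (there x∈p) = x∈p⇒1+∣p-x∣≡∣p∣ p x∈p

module Counting where
  open Sums ℕ.+-*-commutativeSemiring public
  open import Data.Nat using (_+_; _*_; _∸_; _<_; _<?_)
  open ≡ using (refl; sym; trans; cong; cong₂)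
  open ≡.≡-Reasoning

  count-∑ : ∀ {p n} {P : Fin n → Set p} (P? : ∀ i → Dec (P i)) → count P? ≡ ∑ (allFin n) (𝟙 ∘ P?)
  count-∑ {n = n} P? =
    trans (cong (foldr _+_ 0) (List.map-cong (λ i → trans (sym (ℕ.+-identityʳ _)) (count-singleton (P? i)))
                                             (allFin n)))
          (sym (∑-foldr (allFin n) (𝟙 ∘ P?)))
    where
    count-singleton : ∀ {p} {A : Set p} (d : Dec A) → count {n = 1} (λ _ → d) ≡ 𝟙 d
    count-singleton (yes _) = refl
    count-singleton (no _)  = refl

  count-cong : ∀ {p q n} {P : Fin n → Set p} {Q : Fin n → Set q}
               (P? : ∀ i → Dec (P i)) (Q? : ∀ i → Dec (Q i)) →
               (∀ i → P i → Q i) → (∀ i → Q i → P i) → count P? ≡ count Q?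
  count-cong {n = n} P? Q? to from = begin
    count P?              ≡⟨ count-∑ P? ⟩
    ∑ (allFin n) (𝟙 ∘ P?) ≡⟨ ∑-cong (allFin n) (λ i → 𝟙-cong (P? i) (Q? i) (to i) (from i)) ⟩
    ∑ (allFin n) (𝟙 ∘ Q?) ≡⟨ count-∑ Q? ⟨
    count Q?              ∎

  ∑-allFin-const : ∀ n x → ∑ (allFin n) (λ _ → x) ≡ n * x
  ∑-allFin-const ℕ.zero    x = refl
  ∑-allFin-const (ℕ.suc n) x = trans (∑-allFin-suc n _) (cong (x +_) (∑-allFin-const n x))

  ∑-𝟙-> : ∀ n s → ∑ (allFin n) (λ s′ → 𝟙 (s <? toℕ s′)) ≡ n ∸ ℕ.suc s
  ∑-𝟙-> ℕ.zero    s         = refl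
  ∑-𝟙-> (ℕ.suc n) ℕ.zero    =
    trans (∑-allFin-suc n (λ s′ → 𝟙 (0 <? toℕ s′))) (trans (∑-allFin-const n 1) (ℕ.*-identityʳ n))
  ∑-𝟙-> (ℕ.suc n) (ℕ.suc s) = trans (∑-allFin-suc n (λ s′ → 𝟙 (ℕ.suc s <? toℕ s′))) (∑-𝟙-> n s)

  -- (d + r) mod (o + r + 1) exceeds r exactly when 1 ≤ d ≤ o.
  ∑-𝟙-rotated : ∀ {n} o r → n ≡ o + r → ∑ (allFin (ℕ.suc n)) (λ d → 𝟙 (r <? (toℕ d + r) % ℕ.suc n)) ≡ o
  ∑-𝟙-rotated o r refl = begin
    ∑ (allFin (ℕ.suc o + r)) F                      ≡⟨ ∑-allFin-+ (ℕ.suc o) r F ⟩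
    ∑ (allFin (ℕ.suc o)) (F ∘ (_↑ˡ r)) + ∑ (allFin r) (F ∘ (ℕ.suc o ↑ʳ_))
      ≡⟨ cong₂ _+_ (∑-cong (allFin (ℕ.suc o)) front) (∑-zero (allFin r) back) ⟩
    ∑ (allFin (ℕ.suc o)) (λ d → 𝟙 (0 <? toℕ d)) + 0 ≡⟨ cong (_+ 0) (∑-𝟙-> (ℕ.suc o) 0) ⟩
    o + 0                                           ≡⟨ ℕ.+-identityʳ o ⟩
    o                                               ∎
    where
    M : ℕ
    M = ℕ.suc (o + r)
    F : Fin (ℕ.suc o + r) → ℕ
    F d = 𝟙 (r <? (toℕ d + r) % M)
    front : ∀ d → F (d ↑ˡ r) ≡ 𝟙 (0 <? toℕ d)
    front d = 𝟙-cong (r <? _) (0 <? toℕ d)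
      (λ r<d+r → ℕ.+-cancelʳ-< r 0 (toℕ d) (≡.subst (r <_) d+r%M r<d+r))
      (λ 0<d → ≡.subst (r <_) (sym d+r%M) (ℕ.+-monoˡ-< r 0<d))
      where
      d+r%M : (toℕ (d ↑ˡ r) + r) % M ≡ toℕ d + r
      d+r%M = trans (cong (λ x → (x + r) % M) (Fin.toℕ-↑ˡ d r))
                    (m<n⇒m%n≡m (ℕ.s≤s (ℕ.+-monoˡ-≤ r (ℕ.≤-pred (toℕ<n d)))))
    back : ∀ e → F (ℕ.suc o ↑ʳ e) ≡ 0
    back e = 𝟙-no (r <? _) (λ r<e → ℕ.<-asym (toℕ<n e) (≡.subst (r <_) e+M%M r<e))
      where
      e+M%M : (toℕ (ℕ.suc o ↑ʳ e) + r) % M ≡ toℕ e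
      e+M%M = begin
        (toℕ (ℕ.suc o ↑ʳ e) + r) % M ≡⟨ cong (λ x → (x + r) % M) (Fin.toℕ-↑ʳ (ℕ.suc o) e) ⟩
        (ℕ.suc o + toℕ e + r) % M    ≡⟨ cong (λ x → (x + r) % M) (ℕ.+-comm (ℕ.suc o) (toℕ e)) ⟩
        (toℕ e + ℕ.suc o + r) % M    ≡⟨ cong (_% M) (ℕ.+-assoc (toℕ e) (ℕ.suc o) r) ⟩
        (toℕ e + M) % M              ≡⟨ [m+n]%n≡m%n (toℕ e) M ⟩
        toℕ e % M                    ≡⟨ m<n⇒m%n≡m (ℕ.<-trans (toℕ<n e) (ℕ.s≤s (ℕ.m≤n+m r o))) ⟩
        toℕ e                        ∎

  ∑-𝟙-∈ : ∀ {n} (T : Subset n) → ∑ (allFin n) (λ g → 𝟙 (g ∈? T)) ≡ ∣ T ∣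
  ∑-𝟙-∈ []             = refl
  ∑-𝟙-∈ (inside ∷ T)  = trans (∑-allFin-suc _ (λ g → 𝟙 (g ∈? inside ∷ T))) (cong ℕ.suc (∑-𝟙-∈ T))
  ∑-𝟙-∈ (outside ∷ T) = trans (∑-allFin-suc _ (λ g → 𝟙 (g ∈? outside ∷ T))) (∑-𝟙-∈ T)

  above : ∀ {n} → Subset n → Fin n → ℕ
  above (_ ∷ T) zero    = ∣ T ∣
  above (_ ∷ T) (suc g) = above T g

  ∑-∈-above : ∀ {n} (T : Subset n) {g} c (f : Fin n → ℕ) → g ∈ₛ T →
              (∀ g′ → g Fin.< g′ → f g′ ≡ c) → (∀ g′ → g′ Fin.< g → f g′ ≡ 0) →
              ∑ (allFin n) (λ g′ → f g′ * 𝟙 (g′ ∈? T)) ≡ f g + c * above T g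
  ∑-∈-above (inside ∷ T) {zero} c f here after _ = begin
    ∑ (allFin _) (λ g′ → f g′ * 𝟙 (g′ ∈? inside ∷ T))
      ≡⟨ ∑-allFin-suc _ (λ g′ → f g′ * 𝟙 (g′ ∈? inside ∷ T)) ⟩
    f zero * 1 + ∑ (allFin _) (λ g′ → f (suc g′) * 𝟙 (g′ ∈? T))
      ≡⟨ cong₂ _+_ (ℕ.*-identityʳ (f zero))
                   (∑-cong (allFin _) (λ g′ → cong (_* 𝟙 (g′ ∈? T)) (after (suc g′) (ℕ.s≤s ℕ.z≤n)))) ⟩
    f zero + ∑ (allFin _) (λ g′ → c * 𝟙 (g′ ∈? T))
      ≡⟨ cong (f zero +_) (trans (∑-*ˡ (allFin _) c (λ g′ → 𝟙 (g′ ∈? T))) (cong (c *_) (∑-𝟙-∈ T))) ⟩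
    f zero + c * ∣ T ∣ ∎
  ∑-∈-above (b ∷ T) {suc g} c f (there g∈T) after before = begin
    ∑ (allFin _) (λ g′ → f g′ * 𝟙 (g′ ∈? b ∷ T))
      ≡⟨ ∑-allFin-suc _ (λ g′ → f g′ * 𝟙 (g′ ∈? b ∷ T)) ⟩
    f zero * 𝟙 (zero ∈? b ∷ T) + ∑ (allFin _) (λ g′ → f (suc g′) * 𝟙 (g′ ∈? T))
      ≡⟨ cong (λ x → x * 𝟙 (zero ∈? b ∷ T) + ∑ (allFin _) (λ g′ → f (suc g′) * 𝟙 (g′ ∈? T)))
              (before zero (ℕ.s≤s ℕ.z≤n)) ⟩
    ∑ (allFin _) (λ g′ → f (suc g′) * 𝟙 (g′ ∈? T))
      ≡⟨ ∑-∈-above T c (f ∘ suc) g∈T (λ g′ → after (suc g′) ∘ ℕ.s≤s) (λ g′ → before (suc g′) ∘ ℕ.s≤s) ⟩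
    f (suc g) + c * above T g ∎

module Placements (m′ k : ℕ) where
  open import Data.Nat using (_+_; _*_; _∸_; _≤_; _<_)
  open ≡ using (refl; sym; trans; cong; cong₂; subst)
  open ≡.≡-Reasoning

  m N : ℕ
  m = ℕ.suc m′
  N = ℕ.suc (k * m)

  -- How the colours of one base are placed: `inZero o` puts them all in S₀, ordered from
  -- colour o + 1; `inGroup g s` puts colour c in block 1 + m g + ((s + c) mod m).
  data Placement : Set where
    inZero  : Fin m′ → Placement
    inGroup : Fin k → Fin m → Placement

  -- `next` and `pos` do not depend on their implicit arguments n and k.
  ζ : Fin m → Fin m
  ζ = next {n = 0} {k = k}

  position : Fin m → Fin m → ℕ
  position = pos {n = 0} {k = k}

  _⊕_ : Fin m → Fin m → Fin m
  s ⊕ c = (toℕ s + toℕ c) mod m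

  block : Placement → Fin m → Fin N
  block (inZero _)    _ = zero
  block (inGroup g s) c = suc (combine g (s ⊕ c))

  start : Placement → Fin m
  start (inZero o)    = suc o
  start (inGroup _ _) = zero

  toℕ-⊕ : ∀ s c → toℕ (s ⊕ c) ≡ (toℕ s + toℕ c) % m
  toℕ-⊕ s c = toℕ-fromℕ< _

  ⊕-zero : ∀ s → s ⊕ zero ≡ s
  ⊕-zero s = toℕ-injective (trans (toℕ-⊕ s zero)
                                  (trans (cong (_% m) (ℕ.+-identityʳ (toℕ s))) (m<n⇒m%n≡m (toℕ<n s))))

  ⊕-next : ∀ s c → toℕ (s ⊕ ζ c) ≡ ℕ.suc (toℕ (s ⊕ c)) % m
  ⊕-next s c = begin
    toℕ (s ⊕ ζ c)                   ≡⟨ toℕ-⊕ s (ζ c) ⟩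
    (toℕ s + toℕ (ζ c)) % m         ≡⟨ cong (λ x → (toℕ s + x) % m) (toℕ-fromℕ< _) ⟩
    (toℕ s + ℕ.suc (toℕ c) % m) % m ≡⟨ [m+n%d]%d≡[m+n]%d m (toℕ s) (ℕ.suc (toℕ c)) ⟩
    (toℕ s + ℕ.suc (toℕ c)) % m     ≡⟨ cong (_% m) (ℕ.+-suc (toℕ s) (toℕ c)) ⟩
    (1 + (toℕ s + toℕ c)) % m       ≡⟨ [m+n%d]%d≡[m+n]%d m 1 (toℕ s + toℕ c) ⟨
    ℕ.suc ((toℕ s + toℕ c) % m) % m ≡⟨ cong (λ x → ℕ.suc x % m) (toℕ-⊕ s c) ⟨
    ℕ.suc (toℕ (s ⊕ c)) % m         ∎

  ⊕-next-≢ : ∀ s c → toℕ (s ⊕ c) ≢ m′ → toℕ (s ⊕ ζ c) ≡ ℕ.suc (toℕ (s ⊕ c))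
  ⊕-next-≢ s c r≢m′ = trans (⊕-next s c) (m<n⇒m%n≡m (ℕ.s≤s (ℕ.≤∧≢⇒< (ℕ.≤-pred (toℕ<n (s ⊕ c))) r≢m′)))

  ⊕-next-≡ : ∀ s c → toℕ (s ⊕ c) ≡ m′ → toℕ (s ⊕ ζ c) ≡ 0
  ⊕-next-≡ s c r≡m′ = trans (⊕-next s c) (trans (cong (λ x → ℕ.suc x % m) r≡m′) (n%n≡0 m))

  module _ (g : Fin k) (s : Fin m) where
    private
      B : Fin m → Fin N
      B = block (inGroup g s)

    toℕ-block : ∀ c → toℕ (B c) ≡ ℕ.suc (m * toℕ g + toℕ (s ⊕ c))
    toℕ-block c = cong ℕ.suc (toℕ-combine g (s ⊕ c))

    block-next : ∀ c → toℕ (s ⊕ c) ≢ m′ → toℕ (B (ζ c)) ≡ ℕ.suc (toℕ (B c))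
    block-next c r≢m′ = begin
      toℕ (B (ζ c))                           ≡⟨ toℕ-block (ζ c) ⟩
      ℕ.suc (m * toℕ g + toℕ (s ⊕ ζ c))       ≡⟨ cong (λ x → ℕ.suc (m * toℕ g + x)) (⊕-next-≢ s c r≢m′) ⟩
      ℕ.suc (m * toℕ g + ℕ.suc (toℕ (s ⊕ c))) ≡⟨ cong ℕ.suc (ℕ.+-suc (m * toℕ g) _) ⟩
      ℕ.suc (ℕ.suc (m * toℕ g + toℕ (s ⊕ c))) ≡⟨ cong ℕ.suc (toℕ-block c) ⟨
      ℕ.suc (toℕ (B c))                       ∎

    block-∤ : ∀ c → toℕ (s ⊕ c) ≢ m′ → ¬ m ∣ toℕ (B c)
    block-∤ c r≢m′ m∣B = ℕ.1+n≢0 (begin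
      ℕ.suc (toℕ (s ⊕ c))     ≡⟨ m<n⇒m%n≡m (ℕ.s≤s (ℕ.≤∧≢⇒< (ℕ.≤-pred (toℕ<n (s ⊕ c))) r≢m′)) ⟨
      ℕ.suc (toℕ (s ⊕ c)) % m ≡⟨ %-remove-+ˡ (ℕ.suc (toℕ (s ⊕ c))) (m∣m*n (toℕ g)) ⟨
      (m * toℕ g + ℕ.suc (toℕ (s ⊕ c))) % m
        ≡⟨ cong (_% m) (trans (ℕ.+-suc (m * toℕ g) (toℕ (s ⊕ c))) (sym (toℕ-block c))) ⟩
      toℕ (B c) % m           ≡⟨ n∣m⇒m%n≡0 (toℕ (B c)) m m∣B ⟩
      0                       ∎)

    block-wrap-∣ : ∀ c → toℕ (s ⊕ c) ≡ m′ → m ∣ toℕ (B c)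
    block-wrap-∣ c r≡m′ = subst (m ∣_) (sym (begin
      toℕ (B c)                       ≡⟨ toℕ-block c ⟩
      ℕ.suc (m * toℕ g + toℕ (s ⊕ c)) ≡⟨ cong (λ x → ℕ.suc (m * toℕ g + x)) r≡m′ ⟩
      ℕ.suc (m * toℕ g + m′)          ≡⟨ ℕ.+-suc _ m′ ⟨
      m * toℕ g + m                   ≡⟨ ℕ.+-comm _ m ⟩
      m + m * toℕ g                   ≡⟨ ℕ.*-suc m (toℕ g) ⟨
      m * ℕ.suc (toℕ g)               ∎)) (m∣m*n (ℕ.suc (toℕ g)))

    block-wrap-next : ∀ c → toℕ (s ⊕ c) ≡ m′ → toℕ (B (ζ c)) ≡ ℕ.suc (m * toℕ g)
    block-wrap-next c r≡m′ = trans (toℕ-block (ζ c))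
      (cong ℕ.suc (trans (cong (m * toℕ g +_) (⊕-next-≡ s c r≡m′)) (ℕ.+-identityʳ _)))

  record ValidRow (b : Fin m → Fin N) (o : Fin m) : Set where
    field
      zeroClosed : ∀ c d → b c ≡ zero → b d ≡ zero
      rotate     : ∀ l → 1 ≤ l → l < k * m → ¬ (m ∣ l) → ∀ c →
                   (toℕ (b c) ≡ l) ⇔ (toℕ (b (ζ c)) ≡ ℕ.suc l)
      ordIn      : b zero ≡ zero → toℕ o ≢ 0
      ordOut     : b zero ≢ zero → toℕ o ≡ 0

  open ValidRow

  block-rotate : ∀ p l → 1 ≤ l → ¬ (m ∣ l) → ∀ c → (toℕ (block p c) ≡ l) ⇔ (toℕ (block p (ζ c)) ≡ ℕ.suc l)
  block-rotate (inZero _)    l 1≤l _ c = mk⇔ (λ 0≡l → contradiction 0≡l (ℕ.<⇒≢ 1≤l)) (λ ())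
  block-rotate (inGroup g s) l _ m∤l c with toℕ (s ⊕ c) ℕ.≟ m′
  ... | no r≢m′  = mk⇔ (λ e → trans (block-next g s c r≢m′) (cong ℕ.suc e))
                       (λ e → ℕ.suc-injective (trans (sym (block-next g s c r≢m′)) e))
  ... | yes r≡m′ = mk⇔ (λ e → contradiction (subst (m ∣_) e (block-wrap-∣ g s c r≡m′)) m∤l)
                       (λ e → contradiction (subst (m ∣_) (ℕ.suc-injective (trans (sym (block-wrap-next g s c r≡m′)) e))
                                                   (m∣m*n (toℕ g)))
                                            m∤l)

  placement-valid : ∀ p → ValidRow (block p) (start p)
  placement-valid p = record
    { zeroClosed = closed p
    ; rotate     = λ l 1≤l _ m∤l → block-rotate p l 1≤l m∤l
    ; ordIn      = started p
    ; ordOut     = unstarted p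
    }
    where
    closed : ∀ p c d → block p c ≡ zero → block p d ≡ zero
    closed (inZero _)    _ _ _  = refl
    closed (inGroup _ _) _ _ ()
    started : ∀ p → block p zero ≡ zero → toℕ (start p) ≢ 0
    started (inZero _) _ ()
    unstarted : ∀ p → block p zero ≢ zero → toℕ (start p) ≡ 0
    unstarted (inZero _)    b≢0 = contradiction refl b≢0
    unstarted (inGroup _ _) _   = refl

  colourAt : Fin m → ℕ → Fin m
  colourAt s r = (r + (m ∸ toℕ s)) mod m

  ⊕-colourAt : ∀ s r → r < m → toℕ (s ⊕ colourAt s r) ≡ r
  ⊕-colourAt s r r<m = begin
    toℕ (s ⊕ colourAt s r)              ≡⟨ toℕ-⊕ s _ ⟩
    (toℕ s + toℕ (colourAt s r)) % m    ≡⟨ cong (λ x → (toℕ s + x) % m) (toℕ-fromℕ< _) ⟩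
    (toℕ s + (r + (m ∸ toℕ s)) % m) % m ≡⟨ [m+n%d]%d≡[m+n]%d m (toℕ s) _ ⟩
    (toℕ s + (r + (m ∸ toℕ s))) % m
      ≡⟨ cong (_% m) (trans (sym (ℕ.+-assoc (toℕ s) r _)) (m+n+[o∸m]≡n+o r (ℕ.<⇒≤ (toℕ<n s)))) ⟩
    (r + m) % m                         ≡⟨ [m+n]%n≡m%n r m ⟩
    r % m                               ≡⟨ m<n⇒m%n≡m r<m ⟩
    r                                   ∎

  colourAt-⊕ : ∀ s c → colourAt s (toℕ (s ⊕ c)) ≡ c
  colourAt-⊕ s c = toℕ-injective (begin
    toℕ (colourAt s (toℕ (s ⊕ c)))          ≡⟨ toℕ-fromℕ< _ ⟩
    (toℕ (s ⊕ c) + (m ∸ toℕ s)) % m         ≡⟨ cong (λ x → (x + (m ∸ toℕ s)) % m) (toℕ-⊕ s c) ⟩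
    ((toℕ s + toℕ c) % m + (m ∸ toℕ s)) % m ≡⟨ [m%d+n]%d≡[m+n]%d m (toℕ s + toℕ c) _ ⟩
    (toℕ s + toℕ c + (m ∸ toℕ s)) % m       ≡⟨ cong (_% m) (m+n+[o∸m]≡n+o (toℕ c) (ℕ.<⇒≤ (toℕ<n s))) ⟩
    (toℕ c + m) % m                         ≡⟨ [m+n]%n≡m%n (toℕ c) m ⟩
    toℕ c % m                               ≡⟨ m<n⇒m%n≡m (toℕ<n c) ⟩
    toℕ c                                   ∎)

  ζ-colourAt : ∀ s r → ζ (colourAt s r) ≡ colourAt s (ℕ.suc r)
  ζ-colourAt s r = toℕ-injective (begin
    toℕ (ζ (colourAt s r))          ≡⟨ toℕ-fromℕ< _ ⟩
    ℕ.suc (toℕ (colourAt s r)) % m  ≡⟨ cong (λ x → ℕ.suc x % m) (toℕ-fromℕ< _) ⟩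
    (1 + (r + (m ∸ toℕ s)) % m) % m ≡⟨ [m+n%d]%d≡[m+n]%d m 1 _ ⟩
    ℕ.suc (r + (m ∸ toℕ s)) % m     ≡⟨ toℕ-fromℕ< _ ⟨
    toℕ (colourAt s (ℕ.suc r))      ∎)

  -- Rotation links the colours in the cyclic order of their offsets s ⊕ c; only the link
  -- leaving offset m′ is missing, so the offset order is a chain through all colours.
  rotated-row : ∀ {b o} → ValidRow b o → ∀ g s → b zero ≡ block (inGroup g s) zero → ∀ c → b c ≡ block (inGroup g s) c
  rotated-row {b} v g s b₀ c =
    subst P (colourAt-⊕ s c)
          (⇔-chain m step (toℕ<n (s ⊕ zero)) (toℕ<n (s ⊕ c)) (subst P (sym (colourAt-⊕ s zero)) b₀))
    where
    B : Fin m → Fin N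
    B = block (inGroup g s)
    P : Fin m → Set
    P c = b c ≡ B c
    step-ζ : ∀ c → toℕ (s ⊕ c) ≢ m′ → P c ⇔ P (ζ c)
    step-ζ c r≢m′ = mk⇔ (λ e → toℕ-injective (trans (to (cong toℕ e)) (sym (block-next g s c r≢m′))))
                        (λ e → toℕ-injective (from (trans (cong toℕ e) (block-next g s c r≢m′))))
      where
      B<km : toℕ (B c) < k * m
      B<km = ℕ.≤∧≢⇒< (ℕ.≤-pred (toℕ<n (B c))) (λ eq → block-∤ g s c r≢m′ (subst (m ∣_) (sym eq) (n∣m*n k)))
      open Equivalence (rotate v (toℕ (B c)) (ℕ.s≤s ℕ.z≤n) B<km (block-∤ g s c r≢m′) c)
    step : ∀ r → ℕ.suc r < m → P (colourAt s r) ⇔ P (colourAt s (ℕ.suc r))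
    step r 1+r<m = subst (λ c′ → P (colourAt s r) ⇔ P c′) (ζ-colourAt s r) (step-ζ (colourAt s r) r≢m′)
      where
      r≢m′ : toℕ (s ⊕ colourAt s r) ≢ m′
      r≢m′ eq = ℕ.<⇒≢ (ℕ.≤-pred 1+r<m) (trans (sym (⊕-colourAt s r (ℕ.<-trans (ℕ.n<1+n r) 1+r<m))) eq)

  row-placement : ∀ {b o} → ValidRow b o → ∃ λ p → (∀ c → b c ≡ block p c) × o ≡ start p
  row-placement {b} {o} v with b zero in b₀ | o
  ... | zero  | zero   = contradiction refl (ordIn v b₀)
  ... | zero  | suc o′ = inZero o′ , (λ c → zeroClosed v zero c b₀) , refl
  ... | suc j | _      = inGroup g s , rotated-row v g s b₀′
                       , toℕ-injective (ordOut v (λ e → Fin.0≢1+n (trans (sym e) b₀)))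
    where
    g : Fin k
    g = proj₁ (Fin.remQuot {k} m j)
    s : Fin m
    s = proj₂ (Fin.remQuot {k} m j)
    b₀′ : b zero ≡ block (inGroup g s) zero
    b₀′ = trans b₀ (cong suc (trans (sym (combine-remQuot {k} m j)) (cong (combine g) (sym (⊕-zero s)))))

  placement-injective : ∀ {p p′} → block p zero ≡ block p′ zero → start p ≡ start p′ → p ≡ p′
  placement-injective {inZero _}    {inZero _}      _  eq = cong inZero (Fin.suc-injective eq)
  placement-injective {inGroup g s} {inGroup g′ s′} eq _
    with combine-injective g (s ⊕ zero) g′ (s′ ⊕ zero) (Fin.suc-injective eq)
  ... | refl , s≡s′ = cong (inGroup g) (trans (sym (⊕-zero s)) (trans s≡s′ (⊕-zero s′)))

  ValidRow-resp : ∀ {b b′ o} → (∀ c → b c ≡ b′ c) → ValidRow b o → ValidRow b′ o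
  ValidRow-resp b≗b′ v = record
    { zeroClosed = λ c d e → trans (sym (b≗b′ d)) (zeroClosed v c d (trans (b≗b′ c) e))
    ; rotate     = λ l 1≤l l<km m∤l c → ≡.subst₂ _⇔_ (cong (λ x → toℕ x ≡ l) (b≗b′ c))
                                                  (cong (λ x → toℕ x ≡ ℕ.suc l) (b≗b′ (ζ c)))
                                                  (rotate v l 1≤l l<km m∤l c)
    ; ordIn      = λ e → ordIn v (trans (b≗b′ zero) e)
    ; ordOut     = λ b≢0 → ordOut v (b≢0 ∘ trans (sym (b≗b′ zero)))
    }

  encode : ∀ {n} → Vec Placement n → Cand m n k
  encode ps = cand (Vec.map (Vec.tabulate ∘ block) ps) (Vec.map start ps)

  blk-encode : ∀ {n} (ps : Vec Placement n) i c → blk (encode ps) i c ≡ block (lookup ps i) c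
  blk-encode ps i c = trans (cong (λ r → lookup r c) (Vec.lookup-map i _ ps))
                            (Vec.lookup∘tabulate (block (lookup ps i)) c)

  ord-encode : ∀ {n} (ps : Vec Placement n) i → lookup (Cand.ord (encode ps)) i ≡ start (lookup ps i)
  ord-encode ps i = Vec.lookup-map i start ps

  Cand-ext : ∀ {n} {ω ω′ : Cand m n k} → (∀ i c → blk ω i c ≡ blk ω′ i c) →
             (∀ i → lookup (Cand.ord ω) i ≡ lookup (Cand.ord ω′) i) → ω ≡ ω′
  Cand-ext blk≗ ord≗ = cong₂ cand (Pointwise-≡⇒≡ (ext λ i → Pointwise-≡⇒≡ (ext (blk≗ i)))) (Pointwise-≡⇒≡ (ext ord≗))

  encode-injective : ∀ {n} {ps ps′ : Vec Placement n} → encode ps ≡ encode ps′ → ps ≡ ps′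
  encode-injective {ps = ps} {ps′} eq = Pointwise-≡⇒≡ (ext λ i → placement-injective
    (trans (sym (blk-encode ps i zero)) (trans (cong (λ ω → blk ω i zero) eq) (blk-encode ps′ i zero)))
    (trans (sym (ord-encode ps i)) (trans (cong (λ ω → lookup (Cand.ord ω) i) eq) (ord-encode ps′ i))))

  groupOf : Placement → Subset k
  groupOf (inZero _)    = ⊥
  groupOf (inGroup g _) = ⁅ g ⁆

  groups : ∀ {n} → Vec Placement n → Subset k
  groups []       = ⊥
  groups (p ∷ ps) = groupOf p ∪ groups ps

  groups-∷ʳ : ∀ {n} (ps : Vec Placement n) p → groups (ps Vec.∷ʳ p) ≡ groups ps ∪ groupOf p
  groups-∷ʳ []       p = trans (∪-identityʳ (groupOf p)) (sym (∪-identityˡ (groupOf p)))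
  groups-∷ʳ (x ∷ ps) p = trans (cong (groupOf x ∪_) (groups-∷ʳ ps p))
                               (sym (∪-assoc (groupOf x) (groups ps) (groupOf p)))

  ∈-groups⁺ : ∀ {n} (ps : Vec Placement n) i {g s} → lookup ps i ≡ inGroup g s → g ∈ₛ groups ps
  ∈-groups⁺ (_ ∷ _)  zero    refl = x∈p∪q⁺ (inj₁ (x∈⁅x⁆ _))
  ∈-groups⁺ (_ ∷ ps) (suc i) eq   = x∈p∪q⁺ (inj₂ (∈-groups⁺ ps i eq))

  ∈-groups⁻ : ∀ {n} (ps : Vec Placement n) {g} → g ∈ₛ groups ps → ∃ λ i → ∃ λ s → lookup ps i ≡ inGroup g s
  ∈-groups⁻ []       g∈ = contradiction g∈ ∉⊥
  ∈-groups⁻ (p ∷ ps) g∈ with p | x∈p∪q⁻ (groupOf p) (groups ps) g∈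
  ... | inZero _     | inj₁ g∈⊥  = contradiction g∈⊥ ∉⊥
  ... | inGroup g′ s | inj₁ g∈g′ with refl ← x∈⁅y⁆⇒x≡y g′ g∈g′ = zero , s , refl
  ... | _            | inj₂ g∈ps with i , s , eq ← ∈-groups⁻ ps g∈ps = suc i , s , eq

  groupOfBlock : Fin (k * m) → Fin k
  groupOfBlock j = proj₁ (Fin.remQuot {k} m j)

  hit⇒∈groups : ∀ {n} (ps : Vec Placement n) i c j → block (lookup ps i) c ≡ suc j → groupOfBlock j ∈ₛ groups ps
  hit⇒∈groups ps i c j eq with lookup ps i in psᵢ
  ... | inZero _    = contradiction eq Fin.0≢1+n
  ... | inGroup g s = subst (_∈ₛ groups ps)
                            (cong proj₁ (trans (sym (Fin.remQuot-combine g (s ⊕ c)))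
                                               (cong (Fin.remQuot m) (Fin.suc-injective eq))))
                            (∈-groups⁺ ps i psᵢ)

  ∈groups⇒hit : ∀ {n} (ps : Vec Placement n) j → groupOfBlock j ∈ₛ groups ps →
                ∃ λ i → ∃ λ c → block (lookup ps i) c ≡ suc j
  ∈groups⇒hit ps j g∈ with ∈-groups⁻ ps g∈
  ... | i , s′ , psᵢ = i , colourAt s′ (toℕ s) ,
                       trans (cong (λ p → block p (colourAt s′ (toℕ s))) psᵢ) (cong suc (begin
    combine g (s′ ⊕ colourAt s′ (toℕ s)) ≡⟨ cong (combine g) (toℕ-injective (⊕-colourAt s′ (toℕ s) (toℕ<n s))) ⟩
    combine g s                          ≡⟨ combine-remQuot {k} m j ⟩
    j                                    ∎))
    where
    g : Fin k
    g = proj₁ (Fin.remQuot {k} m j)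
    s : Fin m
    s = proj₂ (Fin.remQuot {k} m j)

  encode-isOSSP : ∀ {n} (ps : Vec Placement n) → groups ps ≡ ⊤ → IsOSSP (encode ps)
  encode-isOSSP ps covered = record
    { nonempty   = nonempty
    ; zeroClosed = λ i → zeroClosed (row i)
    ; rotate     = λ l 1≤l l<km m∤l i → rotate (row i) l 1≤l l<km m∤l
    ; ordIn      = λ i → ordIn (row i)
    ; ordOut     = λ i → ordOut (row i)
    }
    where
    row : ∀ i → ValidRow (blk (encode ps) i) (lookup (Cand.ord (encode ps)) i)
    row i = subst (ValidRow _) (sym (ord-encode ps i))
                  (ValidRow-resp (sym ∘ blk-encode ps i) (placement-valid (lookup ps i)))
    nonempty : ∀ l → l ≢ zero → ∃ λ i → ∃ λ c → blk (encode ps) i c ≡ l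
    nonempty zero    l≢0 = contradiction refl l≢0
    nonempty (suc j) _   with ∈groups⇒hit ps j (subst (groupOfBlock j ∈ₛ_) (sym covered) ∈⊤)
    ... | i , c , hit = i , c , trans (blk-encode ps i c) hit

  isOSSP⇒encode : ∀ {n} (ω : Cand m n k) → IsOSSP ω → ∃ λ ps → encode ps ≡ ω × groups ps ≡ ⊤
  isOSSP⇒encode {n} ω isω = ps , ps≡ω , ⊆-antisym (λ _ → ∈⊤) (λ {g} _ → covers g)
    where
    open IsOSSP isω using (nonempty)
    row : ∀ i → ValidRow (blk ω i) (lookup (Cand.ord ω) i)
    row i = record
      { zeroClosed = IsOSSP.zeroClosed isω i
      ; rotate     = λ l 1≤l l<km m∤l → IsOSSP.rotate isω l 1≤l l<km m∤l i
      ; ordIn      = IsOSSP.ordIn isω i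
      ; ordOut     = IsOSSP.ordOut isω i
      }
    ps : Vec Placement n
    ps = Vec.tabulate (λ i → proj₁ (row-placement (row i)))
    blk≗ : ∀ i c → blk ω i c ≡ block (lookup ps i) c
    blk≗ i c = trans (proj₁ (proj₂ (row-placement (row i))) c) (cong (λ p → block p c) (sym (Vec.lookup∘tabulate _ i)))
    ps≡ω : encode ps ≡ ω
    ps≡ω = Cand-ext (λ i c → trans (blk-encode ps i c) (sym (blk≗ i c)))
                    (λ i → trans (ord-encode ps i) (trans (cong start (Vec.lookup∘tabulate _ i))
                                                          (sym (proj₂ (proj₂ (row-placement (row i)))))))
    covers : ∀ g → g ∈ₛ groups ps
    covers g with nonempty (suc (combine g zero)) (λ ())
    ... | i , c , hit = subst (_∈ₛ groups ps) (cong proj₁ (Fin.remQuot-combine g zero))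
                              (hit⇒∈groups ps i c (combine g zero) (trans (sym (blk≗ i c)) hit))

module Inversions (m′ k : ℕ) where
  open import Data.Nat using (_+_; _*_; _∸_; _≤_; _<_; _<?_)
  open import Algebra.Properties.CommutativeSemigroup ℕ.+-commutativeSemigroup using (interchange)
  open ≡ using (refl; sym; trans; cong; cong₂; subst)
  open ≡.≡-Reasoning
  open Placements m′ k
  open Counting

  Covered : Subset k → Fin N → Set
  Covered T zero    = Empty.⊥
  Covered T (suc j) = groupOfBlock j ∈ₛ T

  covered? : ∀ T l → Dec (Covered T l)
  covered? T zero    = no λ ()
  covered? T (suc j) = groupOfBlock j ∈? T

  Rows : ℕ → Set
  Rows n = Vec (Vec (Fin N) m) n

  Hit : ∀ {n} → Rows n → Fin N → Fin n → Set
  Hit B l j = ∃ λ c → lookup (lookup B j) c ≡ l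

  BlockInversion : ∀ {n} → Rows n → Fin n → Fin N → Set
  BlockInversion B i l = (lookup (lookup B i) zero Fin.< l) × (∃ λ j → j Fin.≤ i × Hit B l j)

  blockInversion? : ∀ {n} (B : Rows n) i l → Dec (BlockInversion B i l)
  blockInversion? B i l = (lookup (lookup B i) zero Fin.<? l) ×-dec
                          Fin.any? (λ j → (j Fin.≤? i) ×-dec Fin.any? (λ c → lookup (lookup B j) c Fin.≟ l))

  blockInversions : ∀ {n} → Rows n → Fin n → ℕ
  blockInversions B i = count (blockInversion? B i)

  orderInversion? : ∀ (r : Vec (Fin N) m) o c →
                    Dec ((lookup r zero ≡ zero) × (lookup r c ≡ zero) × (position o zero < position o c))
  orderInversion? r o c =
    (lookup r zero Fin.≟ zero) ×-dec (lookup r c Fin.≟ zero) ×-dec (position o zero <? position o c)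

  orderInversions : Vec (Fin N) m → Fin m → ℕ
  orderInversions r o = count (orderInversion? r o)

  inv₁-∑ : ∀ {n} (ω : Cand m n k) → inv₁ ω ≡ ∑ (allFin n) (blockInversions (Cand.blocks ω))
  inv₁-∑ {n} ω = sym (∑-foldr (allFin n) _)

  inv₂-∑ : ∀ {n} (ω : Cand m n k) →
           inv₂ ω ≡ ∑ (allFin n) (λ i → orderInversions (lookup (Cand.blocks ω) i) (lookup (Cand.ord ω) i))
  inv₂-∑ {n} ω = sym (∑-foldr (allFin n) _)

  blockInversions-inject₁ : ∀ {n} (B : Rows n) r i → blockInversions (B Vec.∷ʳ r) (inject₁ i) ≡ blockInversions B i
  blockInversions-inject₁ B r i = count-cong (blockInversion? (B Vec.∷ʳ r) (inject₁ i)) (blockInversion? B i)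
    (λ l → Product.map (subst (λ row → lookup row zero Fin.< l) (rowᵢ i)) (hits→ l))
    (λ l → Product.map (subst (λ row → lookup row zero Fin.< l) (sym (rowᵢ i))) (hits← l))
    where
    rowᵢ : ∀ j → lookup (B Vec.∷ʳ r) (inject₁ j) ≡ lookup B j
    rowᵢ j = lookup-∷ʳ-inject₁ B r j
    hits→ : ∀ l → (∃ λ j → j Fin.≤ inject₁ i × Hit (B Vec.∷ʳ r) l j) → ∃ λ j → j Fin.≤ i × Hit B l j
    hits→ l h with j , j≤i , hit ← Equivalence.to (∃≤inject₁⇔ {P = Hit (B Vec.∷ʳ r) l} i) h =
      j , j≤i , subst (λ row → ∃ λ c → lookup row c ≡ l) (rowᵢ j) hit
    hits← : ∀ l → (∃ λ j → j Fin.≤ i × Hit B l j) → ∃ λ j → j Fin.≤ inject₁ i × Hit (B Vec.∷ʳ r) l j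
    hits← l (j , j≤i , hit) = Equivalence.from (∃≤inject₁⇔ {P = Hit (B Vec.∷ʳ r) l} i)
      (j , j≤i , subst (λ row → ∃ λ c → lookup row c ≡ l) (sym (rowᵢ j)) hit)

  newBlockInversion? : ∀ T p l → Dec ((block p zero Fin.< l) × Covered T l)
  newBlockInversion? T p l = (block p zero Fin.<? l) ×-dec covered? T l

  newBlockInversions : Subset k → Placement → ℕ
  newBlockInversions T p = count (newBlockInversion? T p)

  newOrderInversions : Placement → ℕ
  newOrderInversions p = orderInversions (Vec.tabulate (block p)) (start p)

  module _ {n} (ps : Vec Placement n) (p : Placement) where
    private
      B : Rows n
      B = Cand.blocks (encode ps)
      ω : Cand m (ℕ.suc n) k
      ω = encode (ps Vec.∷ʳ p)

    blocks-∷ʳ : Cand.blocks ω ≡ B Vec.∷ʳ Vec.tabulate (block p)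
    blocks-∷ʳ = map-∷ʳ (Vec.tabulate ∘ block) ps p

    ord-∷ʳ : Cand.ord ω ≡ Cand.ord (encode ps) Vec.∷ʳ start p
    ord-∷ʳ = map-∷ʳ start ps p

    row-inject₁ : ∀ i → lookup (Cand.blocks ω) (inject₁ i) ≡ lookup B i
    row-inject₁ i = trans (cong (λ B′ → lookup B′ (inject₁ i)) blocks-∷ʳ) (lookup-∷ʳ-inject₁ B _ i)

    row-last : lookup (Cand.blocks ω) (fromℕ n) ≡ Vec.tabulate (block p)
    row-last = trans (cong (λ B′ → lookup B′ (fromℕ n)) blocks-∷ʳ) (lookup-∷ʳ-last B _)

    ord-inject₁ : ∀ i → lookup (Cand.ord ω) (inject₁ i) ≡ lookup (Cand.ord (encode ps)) i
    ord-inject₁ i = trans (cong (λ O → lookup O (inject₁ i)) ord-∷ʳ) (lookup-∷ʳ-inject₁ (Cand.ord (encode ps)) _ i)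

    ord-last : lookup (Cand.ord ω) (fromℕ n) ≡ start p
    ord-last = trans (cong (λ O → lookup O (fromℕ n)) ord-∷ʳ) (lookup-∷ʳ-last (Cand.ord (encode ps)) _)

    blockInversions-last : blockInversions (Cand.blocks ω) (fromℕ n) ≡ newBlockInversions (groups (ps Vec.∷ʳ p)) p
    blockInversions-last =
      count-cong (blockInversion? (Cand.blocks ω) (fromℕ n)) (newBlockInversion? (groups (ps Vec.∷ʳ p)) p) to from
      where
      last-zero : blk ω (fromℕ n) zero ≡ block p zero
      last-zero = trans (blk-encode (ps Vec.∷ʳ p) (fromℕ n) zero) (cong (λ p′ → block p′ zero) (lookup-∷ʳ-last ps p))
      to : ∀ l → (blk ω (fromℕ n) zero Fin.< l) × (∃ λ j → j Fin.≤ fromℕ n × ∃ λ c → blk ω j c ≡ l) →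
           (block p zero Fin.< l) × Covered (groups (ps Vec.∷ʳ p)) l
      to zero    (lt , _)               = contradiction lt ℕ.n≮0
      to (suc l) (lt , j , _ , c , hit) =
        subst (λ b → b Fin.< suc l) last-zero lt ,
        hit⇒∈groups (ps Vec.∷ʳ p) j c l (trans (sym (blk-encode (ps Vec.∷ʳ p) j c)) hit)
      from : ∀ l → (block p zero Fin.< l) × Covered (groups (ps Vec.∷ʳ p)) l →
             (blk ω (fromℕ n) zero Fin.< l) × (∃ λ j → j Fin.≤ fromℕ n × ∃ λ c → blk ω j c ≡ l)
      from (suc l) (lt , covered) with j , c , hit ← ∈groups⇒hit (ps Vec.∷ʳ p) l covered =
        subst (λ b → b Fin.< suc l) (sym last-zero) lt ,
        j , Fin.≤fromℕ j , c , trans (blk-encode (ps Vec.∷ʳ p) j c) hit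

    inv₁-∷ʳ : inv₁ ω ≡ inv₁ (encode ps) + newBlockInversions (groups (ps Vec.∷ʳ p)) p
    inv₁-∷ʳ = begin
      inv₁ ω                                                         ≡⟨ inv₁-∑ ω ⟩
      ∑ (allFin (ℕ.suc n)) (blockInversions (Cand.blocks ω))
        ≡⟨ ∑-allFin-last n (blockInversions (Cand.blocks ω)) ⟩
      ∑ (allFin n) (blockInversions (Cand.blocks ω) ∘ inject₁) + blockInversions (Cand.blocks ω) (fromℕ n)
        ≡⟨ cong₂ _+_ (∑-cong (allFin n) (λ i → trans (cong (λ B′ → blockInversions B′ (inject₁ i)) blocks-∷ʳ)
                                                         (blockInversions-inject₁ B _ i)))
                       blockInversions-last ⟩
      ∑ (allFin n) (blockInversions B) + newBlockInversions (groups (ps Vec.∷ʳ p)) p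
        ≡⟨ cong (_+ newBlockInversions (groups (ps Vec.∷ʳ p)) p) (inv₁-∑ (encode ps)) ⟨
      inv₁ (encode ps) + newBlockInversions (groups (ps Vec.∷ʳ p)) p ∎

    inv₂-∷ʳ : inv₂ ω ≡ inv₂ (encode ps) + newOrderInversions p
    inv₂-∷ʳ = begin
      inv₂ ω                                     ≡⟨ inv₂-∑ ω ⟩
      ∑ (allFin (ℕ.suc n)) (orderInversionsAt ω) ≡⟨ ∑-allFin-last n (orderInversionsAt ω) ⟩
      ∑ (allFin n) (orderInversionsAt ω ∘ inject₁) + orderInversionsAt ω (fromℕ n)
        ≡⟨ cong₂ _+_ (∑-cong (allFin n) (λ i → cong₂ orderInversions (row-inject₁ i) (ord-inject₁ i)))
                     (cong₂ orderInversions row-last ord-last) ⟩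
      ∑ (allFin n) (orderInversionsAt (encode ps)) + newOrderInversions p
        ≡⟨ cong (_+ newOrderInversions p) (inv₂-∑ (encode ps)) ⟨
      inv₂ (encode ps) + newOrderInversions p    ∎
      where
      orderInversionsAt : ∀ {n} → Cand m n k → Fin n → ℕ
      orderInversionsAt ω′ i = orderInversions (lookup (Cand.blocks ω′) i) (lookup (Cand.ord ω′) i)

  precedes? : ∀ p (g′ : Fin k) (s′ : Fin m) → Dec (block p zero Fin.< suc (combine g′ s′))
  precedes? p g′ s′ = block p zero Fin.<? suc (combine g′ s′)

  laterBlocks : Placement → Fin k → ℕ
  laterBlocks p g′ = ∑ (allFin m) (𝟙 ∘ precedes? p g′)

  newBlockInversions-∑ : ∀ T p →
                         newBlockInversions T p ≡ ∑ (allFin k) (λ g′ → laterBlocks p g′ * 𝟙 (g′ ∈? T))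
  newBlockInversions-∑ T p = begin
    newBlockInversions T p                               ≡⟨ count-∑ (newBlockInversion? T p) ⟩
    ∑ (allFin N) (𝟙 ∘ newBlockInversion? T p)            ≡⟨ ∑-allFin-suc (k * m) (𝟙 ∘ newBlockInversion? T p) ⟩
    𝟙 (newBlockInversion? T p zero) + ∑ (allFin (k * m)) (𝟙 ∘ newBlockInversion? T p ∘ suc)
      ≡⟨ cong₂ _+_ (𝟙-no (newBlockInversion? T p zero) (λ { (_ , ()) }))
                   (∑-allFin-combine k m (𝟙 ∘ newBlockInversion? T p ∘ suc)) ⟩
    ∑ (allFin k) (λ g′ → ∑ (allFin m) (λ s′ → 𝟙 (newBlockInversion? T p (suc (combine g′ s′)))))
      ≡⟨ ∑-cong (allFin k) (λ g′ → trans (∑-cong (allFin m) (term g′))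
                                         (∑-*ʳ (allFin m) (𝟙 (g′ ∈? T)) (𝟙 ∘ precedes? p g′))) ⟩
    ∑ (allFin k) (λ g′ → laterBlocks p g′ * 𝟙 (g′ ∈? T)) ∎
    where
    term : ∀ (g′ : Fin k) (s′ : Fin m) →
           𝟙 (newBlockInversion? T p (suc (combine g′ s′))) ≡ 𝟙 (precedes? p g′ s′) * 𝟙 (g′ ∈? T)
    term g′ s′ = trans (𝟙-× (precedes? p g′ s′) (groupOfBlock (combine g′ s′) ∈? T))
                       (cong (λ g → 𝟙 (precedes? p g′ s′) * 𝟙 (g ∈? T))
                             (cong proj₁ (Fin.remQuot-combine g′ s′)))

  laterBlocks-inZero : ∀ o g′ → laterBlocks (inZero o) g′ ≡ m
  laterBlocks-inZero o g′ = trans (∑-allFin-const m 1) (ℕ.*-identityʳ m)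

  module _ (g : Fin k) (s : Fin m) where
    private
      a : ℕ
      a = m * toℕ g + toℕ s

    block<⇔ : ∀ (g′ : Fin k) (s′ : Fin m) →
              (block (inGroup g s) zero Fin.< suc (combine g′ s′)) ⇔ (a < m * toℕ g′ + toℕ s′)
    block<⇔ g′ s′ = mk⇔ (λ lt → ℕ.s<s⁻¹ (≡.subst₂ _<_ eq₁ eq₂ lt))
                        (λ lt → ≡.subst₂ _<_ (sym eq₁) (sym eq₂) (ℕ.s<s lt))
      where
      eq₁ : toℕ (block (inGroup g s) zero) ≡ ℕ.suc a
      eq₁ = trans (toℕ-block g s zero) (cong (λ x → ℕ.suc (m * toℕ g + toℕ x)) (⊕-zero s))
      eq₂ : toℕ (suc (combine g′ s′)) ≡ ℕ.suc (m * toℕ g′ + toℕ s′)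
      eq₂ = cong ℕ.suc (toℕ-combine g′ s′)

    laterBlocks-after : ∀ g′ → g Fin.< g′ → laterBlocks (inGroup g s) g′ ≡ m
    laterBlocks-after g′ g<g′ = trans (∑-cong (allFin m) precedes) (trans (∑-allFin-const m 1) (ℕ.*-identityʳ m))
      where
      precedes : ∀ s′ → 𝟙 (precedes? (inGroup g s) g′ s′) ≡ 1
      precedes s′ = 𝟙-yes (precedes? (inGroup g s) g′ s′)
                          (Equivalence.from (block<⇔ g′ s′) (m*a+s<m*b+t m (toℕ s) (toℕ s′) g<g′ (toℕ<n s)))

    laterBlocks-before : ∀ g′ → g′ Fin.< g → laterBlocks (inGroup g s) g′ ≡ 0
    laterBlocks-before g′ g′<g = ∑-zero (allFin m) (λ s′ → 𝟙-no (precedes? (inGroup g s) g′ s′)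
      (λ lt → ℕ.<-asym (Equivalence.to (block<⇔ g′ s′) lt) (m*a+s<m*b+t m (toℕ s′) (toℕ s) g′<g (toℕ<n s′))))

    laterBlocks-self : laterBlocks (inGroup g s) g ≡ m′ ∸ toℕ s
    laterBlocks-self = trans (∑-cong (allFin m) precedes⇔) (∑-𝟙-> m (toℕ s))
      where
      precedes⇔ : ∀ s′ → 𝟙 (precedes? (inGroup g s) g s′) ≡ 𝟙 (toℕ s <? toℕ s′)
      precedes⇔ s′ = 𝟙-cong (precedes? (inGroup g s) g s′) (toℕ s <? toℕ s′)
                            (ℕ.+-cancelˡ-< (m * toℕ g) (toℕ s) (toℕ s′) ∘ Equivalence.to (block<⇔ g s′))
                            (Equivalence.from (block<⇔ g s′) ∘ ℕ.+-monoʳ-< (m * toℕ g))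

  newOrderInversions-inZero : ∀ o → newOrderInversions (inZero o) ≡ toℕ o
  newOrderInversions-inZero o = begin
    newOrderInversions (inZero o)
      ≡⟨ count-cong (orderInversion? row (suc o)) rotated? to from ⟩
    count rotated?              ≡⟨ count-∑ rotated? ⟩
    ∑ (allFin m) (𝟙 ∘ rotated?) ≡⟨ ∑-𝟙-rotated (toℕ o) r (sym (ℕ.m+[n∸m]≡n (ℕ.<⇒≤ (toℕ<n o)))) ⟩
    toℕ o                       ∎
    where
    row : Vec (Fin N) m
    row = Vec.tabulate (block (inZero o))
    r : ℕ
    r = m′ ∸ toℕ o
    r%m : r % m ≡ r
    r%m = m<n⇒m%n≡m (ℕ.s≤s (ℕ.m∸n≤m m′ (toℕ o)))
    rotated? : ∀ c → Dec (r < (toℕ c + r) % m)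
    rotated? c = r <? (toℕ c + r) % m
    OrderInversion : Fin m → Set
    OrderInversion c = (lookup row zero ≡ zero) × (lookup row c ≡ zero) × (position (suc o) zero < position (suc o) c)
    to : ∀ c → OrderInversion c → r < (toℕ c + r) % m
    to c (_ , _ , lt) = subst (_< (toℕ c + r) % m) r%m lt
    from : ∀ c → r < (toℕ c + r) % m → OrderInversion c
    from c lt = Vec.lookup∘tabulate (block (inZero o)) zero , Vec.lookup∘tabulate (block (inZero o)) c
              , subst (_< (toℕ c + r) % m) (sym r%m) lt

  newOrderInversions-inGroup : ∀ g s → newOrderInversions (inGroup g s) ≡ 0
  newOrderInversions-inGroup g s = trans (count-∑ (orderInversion? row zero)) (∑-zero (allFin m) none)
    where
    row : Vec (Fin N) m
    row = Vec.tabulate (block (inGroup g s))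
    none : ∀ c → 𝟙 (orderInversion? row zero c) ≡ 0
    none c = 𝟙-no (orderInversion? row zero c)
                  (λ (row₀≡0 , _) → Fin.0≢1+n (trans (sym row₀≡0) (Vec.lookup∘tabulate (block (inGroup g s)) zero)))

  -- A base placed in S₀ with its order starting at colour o + 1 is inverted with the m|T| blocks
  -- of the groups in T and with the o colours after i⁰; a base at offset s of group g, with the
  -- m′ − s later blocks of g and the blocks of the groups in T after g.
  newInversions : Subset k → Placement → ℕ
  newInversions T (inZero o)    = m * ∣ T ∣ + toℕ o
  newInversions T (inGroup g s) = (m′ ∸ toℕ s) + m * above T g

  newBlockInversions+newOrderInversions : ∀ T p → (∀ {g s} → p ≡ inGroup g s → g ∈ₛ T) →
                                          newBlockInversions T p + newOrderInversions p ≡ newInversions T p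
  newBlockInversions+newOrderInversions T (inZero o) _ = cong₂ _+_ (begin
    newBlockInversions T (inZero o)       ≡⟨ newBlockInversions-∑ T (inZero o) ⟩
    ∑ (allFin k) (λ g′ → laterBlocks (inZero o) g′ * 𝟙 (g′ ∈? T))
      ≡⟨ ∑-cong (allFin k) (λ g′ → cong (_* 𝟙 (g′ ∈? T)) (laterBlocks-inZero o g′)) ⟩
    ∑ (allFin k) (λ g′ → m * 𝟙 (g′ ∈? T)) ≡⟨ ∑-*ˡ (allFin k) m (λ g′ → 𝟙 (g′ ∈? T)) ⟩
    m * ∑ (allFin k) (λ g′ → 𝟙 (g′ ∈? T)) ≡⟨ cong (m *_) (∑-𝟙-∈ T) ⟩
    m * ∣ T ∣                             ∎) (newOrderInversions-inZero o)
  newBlockInversions+newOrderInversions T (inGroup g s) g∈T = begin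
    newBlockInversions T (inGroup g s) + newOrderInversions (inGroup g s)
      ≡⟨ cong₂ _+_ (newBlockInversions-∑ T (inGroup g s)) (newOrderInversions-inGroup g s) ⟩
    ∑ (allFin k) (λ g′ → laterBlocks (inGroup g s) g′ * 𝟙 (g′ ∈? T)) + 0
      ≡⟨ ℕ.+-identityʳ _ ⟩
    ∑ (allFin k) (λ g′ → laterBlocks (inGroup g s) g′ * 𝟙 (g′ ∈? T))
      ≡⟨ ∑-∈-above T m (laterBlocks (inGroup g s)) (g∈T refl) (laterBlocks-after g s) (laterBlocks-before g s) ⟩
    laterBlocks (inGroup g s) g + m * above T g ≡⟨ cong (_+ m * above T g) (laterBlocks-self g s) ⟩
    (m′ ∸ toℕ s) + m * above T g                ∎

  -- Inversions of a base only involve bases of smaller index, so the earlier bases keep theirs.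
  inv-∷ʳ : ∀ {n} (ps : Vec Placement n) p →
           inv (encode (ps Vec.∷ʳ p)) ≡ inv (encode ps) + newInversions (groups (ps Vec.∷ʳ p)) p
  inv-∷ʳ {n} ps p = begin
    inv₁ (encode (ps Vec.∷ʳ p)) + inv₂ (encode (ps Vec.∷ʳ p))
      ≡⟨ cong₂ _+_ (inv₁-∷ʳ ps p) (inv₂-∷ʳ ps p) ⟩
    (inv₁ (encode ps) + newBlockInversions T p) + (inv₂ (encode ps) + newOrderInversions p)
      ≡⟨ interchange (inv₁ (encode ps)) (newBlockInversions T p) (inv₂ (encode ps)) (newOrderInversions p) ⟩
    inv (encode ps) + (newBlockInversions T p + newOrderInversions p)
      ≡⟨ cong (inv (encode ps) +_) (newBlockInversions+newOrderInversions T p g∈T) ⟩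
    inv (encode ps) + newInversions T p ∎
    where
    T : Subset k
    T = groups (ps Vec.∷ʳ p)
    g∈T : ∀ {g s} → p ≡ inGroup g s → g ∈ₛ T
    g∈T p≡ = ∈-groups⁺ (ps Vec.∷ʳ p) (fromℕ n) (trans (lookup-∷ʳ-last ps p) p≡)

module Enumeration (m′ k : ℕ) where
  open Placements m′ k
  open ≡ using (refl; cong)
  open import Data.List.Membership.Propositional.Properties
    using ( ∈-map⁺; ∈-map⁻; ∈-++⁺ˡ; ∈-++⁺ʳ; ∈-cartesianProductWith⁺; ∈-cartesianProductWith⁻
          ; ∈-allFin; ∈-filter⁺; ∈-filter⁻)
  import Data.List.Relation.Unary.Unique.Propositional.Properties as Unique
  open import Data.List.Relation.Unary.AllPairs using ([]; _∷_)
  open import Data.List.Relation.Unary.All using ([])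
  open import Data.List.Relation.Unary.Any using (here)

  placements : List Placement
  placements = map inZero (allFin m′) ++ cartesianProductWith inGroup (allFin k) (allFin m)

  ∈-placements : ∀ p → p ∈ placements
  ∈-placements (inZero o)    = ∈-++⁺ˡ (∈-map⁺ inZero (∈-allFin o))
  ∈-placements (inGroup g s) =
    ∈-++⁺ʳ (map inZero (allFin m′)) (∈-cartesianProductWith⁺ inGroup (∈-allFin g) (∈-allFin s))

  placements-unique : Unique placements
  placements-unique =
    Unique.++⁺ (Unique.map⁺ (λ { refl → refl }) (Unique.allFin⁺ m′))
               (Unique.cartesianProductWith⁺ inGroup (λ { refl → refl , refl }) (Unique.allFin⁺ k) (Unique.allFin⁺ m))
               disjoint
    where
    disjoint : ∀ {p} → ¬ (p ∈ map inZero (allFin m′) × p ∈ cartesianProductWith inGroup (allFin k) (allFin m))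
    disjoint (p∈zero , p∈group)
      with ∈-map⁻ inZero p∈zero | ∈-cartesianProductWith⁻ inGroup (allFin k) (allFin m) p∈group
    ... | _ , _ , refl | _ , _ , _ , _ , ()

  sequences : ∀ n → List (Vec Placement n)
  sequences ℕ.zero    = [] ∷ []
  sequences (ℕ.suc n) = cartesianProductWith Vec._∷ʳ_ (sequences n) placements

  ∈-sequences : ∀ {n} (ps : Vec Placement n) → ps ∈ sequences n
  ∈-sequences [] = here refl
  ∈-sequences (p ∷ ps) with Vec.initLast (p ∷ ps)
  ... | ps′ , p′ , eq =
    ≡.subst (_∈ sequences _) (≡.sym eq) (∈-cartesianProductWith⁺ Vec._∷ʳ_ (∈-sequences ps′) (∈-placements p′))

  sequences-unique : ∀ n → Unique (sequences n)
  sequences-unique ℕ.zero    = [] ∷ []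
  sequences-unique (ℕ.suc n) = Unique.cartesianProductWith⁺ Vec._∷ʳ_ (λ {ps} {ps′} → Vec.∷ʳ-injective ps ps′)
                                                           (sequences-unique n) placements-unique

  infix 4 _≟ₛ_
  _≟ₛ_ : ∀ (A B : Subset k) → Dec (A ≡ B)
  _≟ₛ_ = Vec.≡-dec Bool._≟_

  covers? : ∀ {n} (ps : Vec Placement n) → Dec (groups ps ≡ ⊤)
  covers? ps = groups ps ≟ₛ ⊤

  ossps : ∀ n → List (Cand m n k)
  ossps n = map encode (filter covers? (sequences n))

  ∈-ossps⇔ : ∀ {n} (ω : Cand m n k) → (ω ∈ ossps n) ⇔ IsOSSP ω
  ∈-ossps⇔ {n} ω = mk⇔ to from
    where
    to : ω ∈ ossps n → IsOSSP ω
    to ω∈ with ps , ps∈ , refl ← ∈-map⁻ encode ω∈ =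
      encode-isOSSP ps (proj₂ (∈-filter⁻ covers? {xs = sequences n} ps∈))
    from : IsOSSP ω → ω ∈ ossps n
    from isω with ps , refl , covered ← isOSSP⇒encode ω isω =
      ∈-map⁺ encode (∈-filter⁺ covers? (∈-sequences ps) covered)

  ossps-unique : ∀ n → Unique (ossps n)
  ossps-unique n = Unique.map⁺ encode-injective (Unique.filter⁺ covers? (sequences-unique n))


module QIdentities {c ℓ} (R : CommutativeSemiring c ℓ) where
  open CommutativeSemiring R hiding (zero)
  open import Relation.Binary.Reasoning.Setoid setoid
  open import Algebra.Solver.Ring.NaturalCoefficients.Default R
  open QAnalogues R
  open Sums R

  pow-+ : ∀ x a b → pow x (a ℕ.+ b) ≈ pow x a * pow x b
  pow-+ x ℕ.zero    b = sym (*-identityˡ _)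
  pow-+ x (ℕ.suc a) b = trans (*-cong refl (pow-+ x a b)) (sym (*-assoc _ _ _))

  qint-+ : ∀ x a b → qint x (a ℕ.+ b) ≈ qint x a + pow x a * qint x b
  qint-+ x ℕ.zero    b = sym (trans (+-identityˡ _) (*-identityˡ _))
  qint-+ x (ℕ.suc a) b = begin
    1# + x * qint x (a ℕ.+ b)                    ≈⟨ +-cong refl (*-cong refl (qint-+ x a b)) ⟩
    1# + x * (qint x a + pow x a * qint x b)
      ≈⟨ solve 4 (λ x A P B → con 1 :+ x :* (A :+ P :* B) := (con 1 :+ x :* A) :+ (x :* P) :* B)
               refl x (qint x a) (pow x a) (qint x b) ⟩
    (1# + x * qint x a) + x * pow x a * qint x b ∎

  ∑-pow-ascending : ∀ x a n → ∑ (allFin n) (λ o → pow x (a ℕ.+ toℕ o)) ≈ pow x a * qint x n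
  ∑-pow-ascending x a ℕ.zero    = sym (zeroʳ _)
  ∑-pow-ascending x a (ℕ.suc n) = begin
    ∑ (allFin (ℕ.suc n)) (λ o → pow x (a ℕ.+ toℕ o))         ≈⟨ ∑-allFin-suc n _ ⟩
    pow x (a ℕ.+ 0) + ∑ (allFin n) (λ o → pow x (a ℕ.+ ℕ.suc (toℕ o)))
      ≈⟨ +-cong (reflexive (≡.cong (pow x) (ℕ.+-identityʳ a)))
                (∑-cong (allFin n) (λ o → reflexive (≡.cong (pow x) (ℕ.+-suc a (toℕ o))))) ⟩
    pow x a + ∑ (allFin n) (λ o → pow x (ℕ.suc a ℕ.+ toℕ o)) ≈⟨ +-cong refl (∑-pow-ascending x (ℕ.suc a) n) ⟩
    pow x a + x * pow x a * qint x n
      ≈⟨ solve 3 (λ P x Q → P :+ x :* P :* Q := P :* (con 1 :+ x :* Q)) refl (pow x a) x (qint x n) ⟩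
    pow x a * qint x (ℕ.suc n)                               ∎

  qint-suc : ∀ x j → qint x (ℕ.suc j) ≈ qint x j + pow x j
  qint-suc x j = begin
    qint x (ℕ.suc j)   ≡⟨ ≡.cong (qint x) (ℕ.+-comm 1 j) ⟩
    qint x (j ℕ.+ 1)   ≈⟨ qint-+ x j 1 ⟩
    qint x j + pow x j * (1# + x * 0#)
      ≈⟨ solve 3 (λ Q P x → Q :+ P :* (con 1 :+ x :* con 0) := Q :+ P) refl (qint x j) (pow x j) x ⟩
    qint x j + pow x j ∎

  ∑-pow-descending : ∀ x b n →
                     ∑ (allFin (ℕ.suc n)) (λ s → pow x ((n ℕ.∸ toℕ s) ℕ.+ b)) ≈ qint x (ℕ.suc n) * pow x b
  ∑-pow-descending x b ℕ.zero    = solve 2 (λ x P → P :+ con 0 := (con 1 :+ x :* con 0) :* P) refl x (pow x b)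
  ∑-pow-descending x b (ℕ.suc n) = begin
    ∑ (allFin (ℕ.suc (ℕ.suc n))) (λ s → pow x ((ℕ.suc n ℕ.∸ toℕ s) ℕ.+ b)) ≈⟨ ∑-allFin-suc (ℕ.suc n) _ ⟩
    pow x (ℕ.suc n ℕ.+ b) + ∑ (allFin (ℕ.suc n)) (λ s → pow x ((n ℕ.∸ toℕ s) ℕ.+ b))
      ≈⟨ +-cong (pow-+ x (ℕ.suc n) b) (∑-pow-descending x b n) ⟩
    pow x (ℕ.suc n) * pow x b + qint x (ℕ.suc n) * pow x b
      ≈⟨ solve 3 (λ P Q B → P :* B :+ Q :* B := (Q :+ P) :* B)
               refl (pow x (ℕ.suc n)) (qint x (ℕ.suc n)) (pow x b) ⟩
    (qint x (ℕ.suc n) + pow x (ℕ.suc n)) * pow x b                         ≈⟨ *-cong (qint-suc x (ℕ.suc n)) refl ⟨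
    qint x (ℕ.suc (ℕ.suc n)) * pow x b                                     ∎

  h-∷ʳ : ∀ xs y d → h (ℕ.suc d) (xs List.∷ʳ y) ≈ y * h d (xs List.∷ʳ y) + h (ℕ.suc d) xs
  h-∷ʳ []       y d         = refl
  h-∷ʳ (x ∷ xs) y ℕ.zero    = begin
    x * 1# + h 1 (xs List.∷ʳ y) ≈⟨ +-cong refl (h-∷ʳ xs y 0) ⟩
    x * 1# + (y * 1# + h 1 xs)
      ≈⟨ solve 3 (λ x y H → x :* con 1 :+ (y :* con 1 :+ H) := y :* con 1 :+ (x :* con 1 :+ H))
               refl x y (h 1 xs) ⟩
    y * 1# + (x * 1# + h 1 xs)  ∎
  h-∷ʳ (x ∷ xs) y (ℕ.suc d) = begin
    x * h (ℕ.suc d) (x ∷ xs List.∷ʳ y) + h (ℕ.suc (ℕ.suc d)) (xs List.∷ʳ y)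
      ≈⟨ +-cong (*-cong refl (h-∷ʳ (x ∷ xs) y d)) (h-∷ʳ xs y (ℕ.suc d)) ⟩
    x * (y * A + C) + (y * B + D)
      ≈⟨ solve 6 (λ x y A B C D → x :* (y :* A :+ C) :+ (y :* B :+ D) := y :* (x :* A :+ B) :+ (x :* C :+ D))
               refl x y A B C D ⟩
    y * (x * A + B) + (x * C + D) ∎
    where
    A B C D : Carrier
    A = h d (x ∷ xs List.∷ʳ y)
    B = h (ℕ.suc d) (xs List.∷ʳ y)
    C = h (ℕ.suc d) (x ∷ xs)
    D = h (ℕ.suc (ℕ.suc d)) xs

  hdiff-∷ʳ : ∀ xs y n t → hdiff n t (xs List.∷ʳ y) ≈ y * hdiff n (ℕ.suc t) (xs List.∷ʳ y) + hdiff n t xs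
  hdiff-∷ʳ xs y ℕ.zero    ℕ.zero    = sym (trans (+-cong (zeroʳ y) refl) (+-identityˡ 1#))
  hdiff-∷ʳ xs y (ℕ.suc n) ℕ.zero    = h-∷ʳ xs y n
  hdiff-∷ʳ xs y ℕ.zero    (ℕ.suc t) = sym (trans (+-cong (zeroʳ y) refl) (+-identityˡ 0#))
  hdiff-∷ʳ xs y (ℕ.suc n) (ℕ.suc t) = hdiff-∷ʳ xs y n t

  module _ (q : Carrier) (m′ : ℕ) where
    private
      m : ℕ
      m = ℕ.suc m′

    args-∷ʳ : ∀ t → args q m (ℕ.suc t) ≡.≡ args q m t List.∷ʳ qint q (m′ ℕ.+ ℕ.suc t ℕ.* m)
    args-∷ʳ t = ≡.trans (map-allFin-toℕ f (ℕ.suc (ℕ.suc t)))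
                (≡.trans (≡.sym (List.applyUpTo-∷ʳ f (ℕ.suc t)))
                         (≡.cong (List._∷ʳ f (ℕ.suc t)) (≡.sym (map-allFin-toℕ f (ℕ.suc t)))))
      where
      f : ℕ → Carrier
      f j = qint q (ℕ.suc j ℕ.* m ℕ.∸ 1)

    Stilde-suc : ∀ n t → Stilde q m (ℕ.suc n) t ≈
                         qint q (m′ ℕ.+ t ℕ.* m) * Stilde q m n t + qint q (t ℕ.* m) * Stilde q m n (ℕ.pred t)
    Stilde-suc n ℕ.zero    =
      solve 2 (λ x H → con 1 :* (x :* H :+ con 0) := x :* (con 1 :* H) :+ con 0 :* (con 1 :* H))
            refl (qint q (m′ ℕ.+ 0)) (h n (qint q (m′ ℕ.+ 0) ∷ []))
    Stilde-suc n (ℕ.suc t) = begin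
      F * B * hdiff n t (args q m (ℕ.suc t))
        ≡⟨ ≡.cong (λ xs → F * B * hdiff n t xs) (args-∷ʳ t) ⟩
      F * B * hdiff n t (args q m t List.∷ʳ y) ≈⟨ *-cong refl (hdiff-∷ʳ (args q m t) y n t) ⟩
      F * B * (y * hdiff n (ℕ.suc t) (args q m t List.∷ʳ y) + H₀)
        ≡⟨ ≡.cong (λ xs → F * B * (y * hdiff n (ℕ.suc t) xs + H₀)) (≡.sym (args-∷ʳ t)) ⟩
      F * B * (y * H₁ + H₀)
        ≈⟨ solve 5 (λ F B y H₁ H₀ → F :* B :* (y :* H₁ :+ H₀) := y :* (F :* B :* H₁) :+ B :* (F :* H₀))
                 refl F B y H₁ H₀ ⟩
      y * (F * B * H₁) + B * (F * H₀)          ∎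
      where
      F B y H₁ H₀ : Carrier
      F  = qfactm q m t
      B  = qint q (ℕ.suc t ℕ.* m)
      y  = qint q (m′ ℕ.+ ℕ.suc t ℕ.* m)
      H₁ = hdiff n (ℕ.suc t) (args q m (ℕ.suc t))
      H₀ = hdiff n t (args q m t)


module WeightedCount {c ℓ} (R : CommutativeSemiring c ℓ) (q : CommutativeSemiring.Carrier R) (m′ k : ℕ) where
  open CommutativeSemiring R hiding (zero)
  open import Relation.Binary.Reasoning.Setoid setoid
  open import Algebra.Solver.Ring.NaturalCoefficients.Default R
  open QAnalogues R
  open Sums R
  open QIdentities R
  open Placements m′ k
  open Inversions m′ k using (newInversions; inv-∷ʳ)
  open Enumeration m′ k
  open Counting using (above)

  weight : ∀ {n} → Vec Placement n → Carrier
  weight ps = pow q (inv (encode ps))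

  coveringWeight : ∀ {n} → Subset k → Vec Placement n → Carrier
  coveringWeight T ps = 𝟙 (groups ps ≟ₛ T) * weight ps

  coveringSum : ℕ → Subset k → Carrier
  coveringSum n T = ∑ (sequences n) (coveringWeight T)

  coveringWeight-∷ʳ : ∀ {n} T (ps : Vec Placement n) p →
                      coveringWeight T (ps Vec.∷ʳ p) ≈
                      𝟙 (groups ps ∪ groupOf p ≟ₛ T) * (weight ps * pow q (newInversions T p))
  coveringWeight-∷ʳ T ps p = begin
    𝟙 (groups (ps Vec.∷ʳ p) ≟ₛ T) * weight (ps Vec.∷ʳ p)
      ≈⟨ 𝟙-*-cong (groups (ps Vec.∷ʳ p) ≟ₛ T) weight-∷ʳ ⟩
    𝟙 (groups (ps Vec.∷ʳ p) ≟ₛ T) * (weight ps * pow q (newInversions T p))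
      ≡⟨ ≡.cong (λ U → 𝟙 (U ≟ₛ T) * (weight ps * pow q (newInversions T p))) (groups-∷ʳ ps p) ⟩
    𝟙 (groups ps ∪ groupOf p ≟ₛ T) * (weight ps * pow q (newInversions T p)) ∎
    where
    weight-∷ʳ : groups (ps Vec.∷ʳ p) ≡ T → weight (ps Vec.∷ʳ p) ≈ weight ps * pow q (newInversions T p)
    weight-∷ʳ ≡.refl = trans (reflexive (≡.cong (pow q) (inv-∷ʳ ps p))) (pow-+ q (inv (encode ps)) _)

  𝟙-∪⁅⁆ : ∀ (A T : Subset k) g → 𝟙 (A ∪ ⁅ g ⁆ ≟ₛ T) ≈ 𝟙 (g ∈? T) * (𝟙 (A ≟ₛ T) + 𝟙 (A ≟ₛ T - g))
  𝟙-∪⁅⁆ A T g with g ∈? T | g ∈? A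
  ... | no g∉T  | _       = trans (𝟙-no (A ∪ ⁅ g ⁆ ≟ₛ T) (λ eq → g∉T (≡.subst (g ∈ₛ_) eq (x∈p∪q⁺ (inj₂ (x∈⁅x⁆ g))))))
                                  (sym (zeroˡ _))
  ... | yes g∈T | yes g∈A = begin
    𝟙 (A ∪ ⁅ g ⁆ ≟ₛ T)
      ≈⟨ 𝟙-cong (A ∪ ⁅ g ⁆ ≟ₛ T) (A ≟ₛ T) (≡.trans (≡.sym (x∈p⇒p∪⁅x⁆≡p A g∈A))) (≡.trans (x∈p⇒p∪⁅x⁆≡p A g∈A)) ⟩
    𝟙 (A ≟ₛ T)                         ≈⟨ +-identityʳ _ ⟨
    𝟙 (A ≟ₛ T) + 0#                    ≈⟨ +-cong refl (𝟙-no (A ≟ₛ T - g) (λ { ≡.refl → x∉p-x T g g∈A })) ⟨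
    𝟙 (A ≟ₛ T) + 𝟙 (A ≟ₛ T - g)        ≈⟨ *-identityˡ _ ⟨
    1# * (𝟙 (A ≟ₛ T) + 𝟙 (A ≟ₛ T - g)) ∎
  ... | yes g∈T | no g∉A  = begin
    𝟙 (A ∪ ⁅ g ⁆ ≟ₛ T)
      ≈⟨ 𝟙-cong (A ∪ ⁅ g ⁆ ≟ₛ T) (A ≟ₛ T - g) (λ eq → ≡.trans (≡.sym (x∉p⇒[p∪⁅x⁆]-x≡p A g∉A)) (≡.cong (_- g) eq))
                                             (λ { ≡.refl → x∈p⇒[p-x]∪⁅x⁆≡p T g∈T }) ⟩
    𝟙 (A ≟ₛ T - g)                     ≈⟨ +-identityˡ _ ⟨
    0# + 𝟙 (A ≟ₛ T - g)                ≈⟨ +-cong (𝟙-no (A ≟ₛ T) (λ { ≡.refl → g∉A g∈T })) refl ⟨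
    𝟙 (A ≟ₛ T) + 𝟙 (A ≟ₛ T - g)        ≈⟨ *-identityˡ _ ⟨
    1# * (𝟙 (A ≟ₛ T) + 𝟙 (A ≟ₛ T - g)) ∎

  coveringWeight-inZero : ∀ {n} T (ps : Vec Placement n) o →
                          coveringWeight T (ps Vec.∷ʳ inZero o) ≈ coveringWeight T ps * pow q (m ℕ.* ∣ T ∣ ℕ.+ toℕ o)
  coveringWeight-inZero T ps o = begin
    coveringWeight T (ps Vec.∷ʳ inZero o) ≈⟨ coveringWeight-∷ʳ T ps (inZero o) ⟩
    𝟙 (groups ps ∪ ⊥ ≟ₛ T) * (weight ps * P)
      ≡⟨ ≡.cong (λ U → 𝟙 (U ≟ₛ T) * (weight ps * P)) (∪-identityʳ (groups ps)) ⟩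
    𝟙 (groups ps ≟ₛ T) * (weight ps * P)  ≈⟨ *-assoc _ _ _ ⟨
    coveringWeight T ps * P               ∎
    where
    P : Carrier
    P = pow q (m ℕ.* ∣ T ∣ ℕ.+ toℕ o)

  coveringWeight-inGroup : ∀ {n} T (ps : Vec Placement n) g s →
                           coveringWeight T (ps Vec.∷ʳ inGroup g s) ≈
                           𝟙 (g ∈? T) * (pow q ((m′ ℕ.∸ toℕ s) ℕ.+ m ℕ.* above T g) *
                                         (coveringWeight T ps + coveringWeight (T - g) ps))
  coveringWeight-inGroup T ps g s = begin
    coveringWeight T (ps Vec.∷ʳ inGroup g s)                             ≈⟨ coveringWeight-∷ʳ T ps (inGroup g s) ⟩
    𝟙 (groups ps ∪ ⁅ g ⁆ ≟ₛ T) * (weight ps * P)                         ≈⟨ *-cong (𝟙-∪⁅⁆ (groups ps) T g) refl ⟩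
    𝟙 (g ∈? T) * (𝟙 (groups ps ≟ₛ T) + 𝟙 (groups ps ≟ₛ T - g)) * (weight ps * P)
      ≈⟨ solve 5 (λ I a b w P → I :* (a :+ b) :* (w :* P) := I :* (P :* (a :* w :+ b :* w)))
               refl (𝟙 (g ∈? T)) (𝟙 (groups ps ≟ₛ T)) (𝟙 (groups ps ≟ₛ T - g)) (weight ps) P ⟩
    𝟙 (g ∈? T) * (P * (coveringWeight T ps + coveringWeight (T - g) ps)) ∎
    where
    P : Carrier
    P = pow q ((m′ ℕ.∸ toℕ s) ℕ.+ m ℕ.* above T g)

  inZeroFactor : Subset k → Carrier
  inZeroFactor T = pow q (m ℕ.* ∣ T ∣) * qint q m′

  inGroupFactor : Subset k → Fin k → Carrier
  inGroupFactor T g = qint q m * pow q (m ℕ.* above T g)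

  inGroupTerm : (Subset k → Carrier) → Subset k → Fin k → Carrier
  inGroupTerm W T g = 𝟙 (g ∈? T) * (inGroupFactor T g * (W T + W (T - g)))

  ∑-coveringWeight-∷ʳ : ∀ {n} T (ps : Vec Placement n) →
                        ∑ placements (λ p → coveringWeight T (ps Vec.∷ʳ p)) ≈
                        coveringWeight T ps * inZeroFactor T +
                        ∑ (allFin k) (inGroupTerm (λ U → coveringWeight U ps) T)
  ∑-coveringWeight-∷ʳ T ps = begin
    ∑ placements f                                                          ≈⟨ ∑-++ (map inZero (allFin m′)) _ f ⟩
    ∑ (map inZero (allFin m′)) f + ∑ (cartesianProductWith inGroup (allFin k) (allFin m)) f
      ≈⟨ +-cong (reflexive (∑-map inZero (allFin m′) f)) (∑-cartesianProductWith inGroup (allFin k) (allFin m) f) ⟩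
    ∑ (allFin m′) (f ∘ inZero) + ∑ (allFin k) (λ g → ∑ (allFin m) (f ∘ inGroup g))
      ≈⟨ +-cong zeroPart (∑-cong (allFin k) groupPart) ⟩
    coveringWeight T ps * inZeroFactor T + ∑ (allFin k) (inGroupTerm (λ U → coveringWeight U ps) T) ∎
    where
    f : Placement → Carrier
    f p = coveringWeight T (ps Vec.∷ʳ p)
    X : Fin k → Carrier
    X g = coveringWeight T ps + coveringWeight (T - g) ps
    zeroPart : ∑ (allFin m′) (f ∘ inZero) ≈ coveringWeight T ps * inZeroFactor T
    zeroPart = begin
      ∑ (allFin m′) (f ∘ inZero)                      ≈⟨ ∑-cong (allFin m′) (coveringWeight-inZero T ps) ⟩
      ∑ (allFin m′) (λ o → coveringWeight T ps * P o) ≈⟨ ∑-*ˡ (allFin m′) _ P ⟩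
      coveringWeight T ps * ∑ (allFin m′) P           ≈⟨ *-cong refl (∑-pow-ascending q (m ℕ.* ∣ T ∣) m′) ⟩
      coveringWeight T ps * inZeroFactor T            ∎
      where
      P : Fin m′ → Carrier
      P o = pow q (m ℕ.* ∣ T ∣ ℕ.+ toℕ o)
    groupPart : ∀ g → ∑ (allFin m) (f ∘ inGroup g) ≈ inGroupTerm (λ U → coveringWeight U ps) T g
    groupPart g = begin
      ∑ (allFin m) (f ∘ inGroup g)                  ≈⟨ ∑-cong (allFin m) (coveringWeight-inGroup T ps g) ⟩
      ∑ (allFin m) (λ s → 𝟙 (g ∈? T) * (P s * X g)) ≈⟨ ∑-*ˡ (allFin m) _ _ ⟩
      𝟙 (g ∈? T) * ∑ (allFin m) (λ s → P s * X g)   ≈⟨ *-cong refl (∑-*ʳ (allFin m) (X g) P) ⟩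
      𝟙 (g ∈? T) * (∑ (allFin m) P * X g)           ≈⟨ *-cong refl (*-cong (∑-pow-descending q _ m′) refl) ⟩
      𝟙 (g ∈? T) * (inGroupFactor T g * X g)        ∎
      where
      P : Fin m → Carrier
      P s = pow q ((m′ ℕ.∸ toℕ s) ℕ.+ m ℕ.* above T g)

  coveringSum-suc : ∀ n T → coveringSum (ℕ.suc n) T ≈
                            coveringSum n T * inZeroFactor T + ∑ (allFin k) (inGroupTerm (coveringSum n) T)
  coveringSum-suc n T = begin
    ∑ (cartesianProductWith Vec._∷ʳ_ (sequences n) placements) (coveringWeight T)
      ≈⟨ ∑-cartesianProductWith Vec._∷ʳ_ (sequences n) placements (coveringWeight T) ⟩
    ∑ (sequences n) (λ ps → ∑ placements (λ p → coveringWeight T (ps Vec.∷ʳ p)))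
      ≈⟨ ∑-cong (sequences n) (∑-coveringWeight-∷ʳ T) ⟩
    ∑ (sequences n) (λ ps → coveringWeight T ps * inZeroFactor T + ∑ (allFin k) (F ps))
      ≈⟨ ∑-+ (sequences n) _ _ ⟩
    ∑ (sequences n) (λ ps → coveringWeight T ps * inZeroFactor T) + ∑ (sequences n) (λ ps → ∑ (allFin k) (F ps))
      ≈⟨ +-cong (∑-*ʳ (sequences n) (inZeroFactor T) (coveringWeight T)) (∑-comm (sequences n) (allFin k) F) ⟩
    coveringSum n T * inZeroFactor T + ∑ (allFin k) (λ g → ∑ (sequences n) (λ ps → F ps g))
      ≈⟨ +-cong refl (∑-cong (allFin k) ∑-F) ⟩
    coveringSum n T * inZeroFactor T + ∑ (allFin k) (inGroupTerm (coveringSum n) T) ∎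
    where
    F : Vec Placement n → Fin k → Carrier
    F ps = inGroupTerm (λ U → coveringWeight U ps) T
    ∑-F : ∀ g → ∑ (sequences n) (λ ps → F ps g) ≈ inGroupTerm (coveringSum n) T g
    ∑-F g = trans (∑-*ˡ (sequences n) _ _)
                  (*-cong refl (trans (∑-*ˡ (sequences n) _ _) (*-cong refl (∑-+ (sequences n) _ _))))

  ∑-inGroupFactor : ∀ {n} (T : Subset n) →
                    ∑ (allFin n) (λ g → 𝟙 (g ∈? T) * (qint q m * pow q (m ℕ.* above T g))) ≈ qint q (∣ T ∣ ℕ.* m)
  ∑-inGroupFactor []      = refl
  ∑-inGroupFactor (b ∷ T) = begin
    ∑ (allFin _) (λ g → 𝟙 (g ∈? b ∷ T) * (qint q m * pow q (m ℕ.* above (b ∷ T) g)))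
      ≈⟨ ∑-allFin-suc _ (λ g → 𝟙 (g ∈? b ∷ T) * (qint q m * pow q (m ℕ.* above (b ∷ T) g))) ⟩
    𝟙 (zero ∈? b ∷ T) * (qint q m * pow q (m ℕ.* t)) +
    ∑ (allFin _) (λ g → 𝟙 (g ∈? T) * (qint q m * pow q (m ℕ.* above T g)))
      ≈⟨ +-cong refl (∑-inGroupFactor T) ⟩
    𝟙 (zero ∈? b ∷ T) * (qint q m * pow q (m ℕ.* t)) + qint q (t ℕ.* m) ≈⟨ first b ⟩
    qint q (∣ b ∷ T ∣ ℕ.* m)                                            ∎
    where
    t : ℕ
    t = ∣ T ∣
    first : ∀ b → 𝟙 (zero ∈? b ∷ T) * (qint q m * pow q (m ℕ.* t)) + qint q (t ℕ.* m) ≈ qint q (∣ b ∷ T ∣ ℕ.* m)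
    first outside = trans (+-cong (zeroˡ _) refl) (+-identityˡ _)
    first inside  = begin
      1# * (qint q m * pow q (m ℕ.* t)) + qint q (t ℕ.* m)
        ≈⟨ solve 3 (λ Q P Q′ → con 1 :* (Q :* P) :+ Q′ := Q′ :+ P :* Q)
                 refl (qint q m) (pow q (m ℕ.* t)) (qint q (t ℕ.* m)) ⟩
      qint q (t ℕ.* m) + pow q (m ℕ.* t) * qint q m
        ≡⟨ ≡.cong (λ e → qint q (t ℕ.* m) + pow q e * qint q m) (ℕ.*-comm m t) ⟩
      qint q (t ℕ.* m) + pow q (t ℕ.* m) * qint q m ≈⟨ qint-+ q (t ℕ.* m) m ⟨
      qint q (t ℕ.* m ℕ.+ m)                        ≡⟨ ≡.cong (qint q) (ℕ.+-comm (t ℕ.* m) m) ⟩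
      qint q (m ℕ.+ t ℕ.* m)                        ∎

  ∑-inGroupTerm : ∀ W T Y → (∀ g → g ∈ₛ T → W T + W (T - g) ≈ Y) →
                  ∑ (allFin k) (inGroupTerm W T) ≈ qint q (∣ T ∣ ℕ.* m) * Y
  ∑-inGroupTerm W T Y W≈Y = begin
    ∑ (allFin k) (inGroupTerm W T)
      ≈⟨ ∑-cong (allFin k) (λ g → 𝟙-*-cong (g ∈? T) (*-cong refl ∘ W≈Y g)) ⟩
    ∑ (allFin k) (λ g → 𝟙 (g ∈? T) * (inGroupFactor T g * Y)) ≈⟨ ∑-cong (allFin k) (λ g → sym (*-assoc _ _ _)) ⟩
    ∑ (allFin k) (λ g → 𝟙 (g ∈? T) * inGroupFactor T g * Y)   ≈⟨ ∑-*ʳ (allFin k) Y _ ⟩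
    ∑ (allFin k) (λ g → 𝟙 (g ∈? T) * inGroupFactor T g) * Y   ≈⟨ *-cong (∑-inGroupFactor T) refl ⟩
    qint q (∣ T ∣ ℕ.* m) * Y                                  ∎

  qint-+-inZeroFactor : ∀ T → qint q (∣ T ∣ ℕ.* m) + inZeroFactor T ≈ qint q (m′ ℕ.+ ∣ T ∣ ℕ.* m)
  qint-+-inZeroFactor T = begin
    qint q (t ℕ.* m) + pow q (m ℕ.* t) * qint q m′
      ≡⟨ ≡.cong (λ e → qint q (t ℕ.* m) + pow q e * qint q m′) (ℕ.*-comm m t) ⟩
    qint q (t ℕ.* m) + pow q (t ℕ.* m) * qint q m′ ≈⟨ qint-+ q (t ℕ.* m) m′ ⟨
    qint q (t ℕ.* m ℕ.+ m′)                        ≡⟨ ≡.cong (qint q) (ℕ.+-comm (t ℕ.* m) m′) ⟩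
    qint q (m′ ℕ.+ t ℕ.* m)                        ∎
    where
    t : ℕ
    t = ∣ T ∣

  coveringSum≈Stilde : ∀ n T → coveringSum n T ≈ Stilde q m n ∣ T ∣
  coveringSum≈Stilde ℕ.zero T with ∣ T ∣ in ∣T∣≡
  ... | ℕ.zero  = trans (+-identityʳ _) (*-cong (𝟙-yes (⊥ ≟ₛ T) (≡.sym (∣p∣≡0⇒p≡⊥ T ∣T∣≡))) refl)
  ... | ℕ.suc t = trans (+-identityʳ _) (trans (*-cong (𝟙-no (⊥ ≟ₛ T) ⊥≢T) refl) (trans (zeroˡ _) (sym (zeroʳ _))))
    where
    ⊥≢T : ⊥ ≢ T
    ⊥≢T ⊥≡T = ℕ.1+n≢0 (≡.trans (≡.sym ∣T∣≡) (≡.trans (≡.cong ∣_∣ (≡.sym ⊥≡T)) (∣⊥∣≡0 k)))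
  coveringSum≈Stilde (ℕ.suc n) T = begin
    coveringSum (ℕ.suc n) T
      ≈⟨ coveringSum-suc n T ⟩
    coveringSum n T * inZeroFactor T + ∑ (allFin k) (inGroupTerm (coveringSum n) T)
      ≈⟨ +-cong (*-cong (coveringSum≈Stilde n T) refl) (∑-inGroupTerm (coveringSum n) T Y IH) ⟩
    S t * inZeroFactor T + qint q (t ℕ.* m) * Y
      ≈⟨ solve 4 (λ S K Q S′ → S :* K :+ Q :* (S :+ S′) := (Q :+ K) :* S :+ Q :* S′)
               refl (S t) (inZeroFactor T) (qint q (t ℕ.* m)) (S (ℕ.pred t)) ⟩
    (qint q (t ℕ.* m) + inZeroFactor T) * S t + qint q (t ℕ.* m) * S (ℕ.pred t)
      ≈⟨ +-cong (*-cong (qint-+-inZeroFactor T) refl) refl ⟩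
    qint q (m′ ℕ.+ t ℕ.* m) * S t + qint q (t ℕ.* m) * S (ℕ.pred t)
      ≈⟨ Stilde-suc q m′ n t ⟨
    Stilde q m (ℕ.suc n) t
      ∎
    where
    t : ℕ
    t = ∣ T ∣
    S : ℕ → Carrier
    S = Stilde q m n
    Y : Carrier
    Y = S t + S (ℕ.pred t)
    IH : ∀ g → g ∈ₛ T → coveringSum n T + coveringSum n (T - g) ≈ Y
    IH g g∈T = +-cong (coveringSum≈Stilde n T)
                      (trans (coveringSum≈Stilde n (T - g)) (reflexive (≡.cong (S ∘ ℕ.pred) (x∈p⇒1+∣p-x∣≡∣p∣ T g∈T))))

  invSum-ossps : ∀ n → invSum q (ossps n) ≈ Stilde q m n k
  invSum-ossps n = begin
    invSum q (map encode (filter covers? (sequences n)))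
      ≡⟨ invSum-∑ (map encode (filter covers? (sequences n))) ⟩
    ∑ (map encode (filter covers? (sequences n))) (pow q ∘ inv)
      ≡⟨ ∑-map encode (filter covers? (sequences n)) (pow q ∘ inv) ⟩
    ∑ (filter covers? (sequences n)) weight ≈⟨ ∑-filter covers? (sequences n) weight ⟩
    coveringSum n ⊤                         ≈⟨ coveringSum≈Stilde n ⊤ ⟩
    Stilde q m n ∣ ⊤ {k} ∣                  ≡⟨ ≡.cong (Stilde q m n) (∣⊤∣≡n k) ⟩
    Stilde q m n k                          ∎
    where
    invSum-∑ : ∀ {n} (ωs : List (Cand m n k)) → invSum q ωs ≡ ∑ ωs (pow q ∘ inv)
    invSum-∑ []       = ≡.refl
    invSum-∑ (ω ∷ ωs) = ≡.cong (pow q (inv ω) +_) (invSum-∑ ωs)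

theorem4p4 : ∀ {c ℓ} (R : CommutativeSemiring c ℓ) (q : CommutativeSemiring.Carrier R)
               (m n k : ℕ) {{_ : NonZero m}} →
               ∃ λ (ωs : List (Cand m n k)) →
                 (∀ (ω : Cand m n k) → (ω ∈ ωs) ⇔ IsOSSP ω)
                 × Unique ωs
                 × CommutativeSemiring._≈_ R (QAnalogues.invSum R q ωs)
                                             (QAnalogues.Stilde R q m n k)
theorem4p4 R q (ℕ.suc m′) n k = ossps n , ∈-ossps⇔ , ossps-unique n , invSum-ossps n
  where
  open Enumeration m′ k
  open WeightedCount R q m′ k
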